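{- Let $1\le k<N$ be integers. The $(i,j)$ entry ($0\le i,j\le N-1$) of $b_k(\alpha_N)$ is $1$ if $|i-j|=k$, $i+j=k-1$, or $i+j=2(N-1)-(k-1)$, and is $0$ otherwise. The $(i,j)$ entry of $b_k(\beta_N)$ is $1$ if $|i-j|=k$ or $i+j=k-1$, is $-1$ if $i+j=2(N-1)-(k-1)$, and is $0$ otherwise. Moreover $b_k(\gamma)=\gamma^{(k)}$, and for every integer $M\ge 0$, $$\det\left(b_k(\gamma)|_M\right)=\begin{cases}(-1)^{kn} & \text{if } M=2kn \text{ for some integer } n\ge0,\\ (-1)^{kn+\binom{k}{2}} & \text{if } M=2kn+k \text{ for some integer } n\ge0,\\ 0 & \text{otherwise.}\end{cases}$$
   Context: $\gamma$ is the infinite matrix indexed by $\mathbb{Z}_{\ge0}$ with $(i,j)$ entry $1$ if $|i-j|=1$ or $i=j=0$, $0$ otherwise; $\gamma^{(k)}$ is the infinite matrix with $(i,j)$ entry $1$ if $|i-j|=k$ or $i+j=k-1$, $0$ otherwise. $M|_n$ is the leading principal $n\times n$ submatrix. $J_N$ is the $N\times N$ exchange matrix, $Q_N=\begin{pmatrix}J_N & I_N\end{pmatrix}$, $\sigma_{2N}(\varepsilon)$ is the $2N\times2N$ matrix with $(i,j)$ entry $1$ if $i=j+1$, $\varepsilon$ if $(i,j)=(0,2N-1)$, $0$ otherwise; $\alpha_N=Q_N\sigma_{2N}(1)Q_N^\top$, $\beta_N=Q_N\sigma_{2N}(-1)Q_N^\top$ (equivalently $\gamma|_N$ with its $(N-1,N-1)$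 entry increased resp. decreased by $1$). For $n\ge1$, $b_n(x)=\det(xI_n-\beta_n)$ is the characteristic polynomial of $\beta_n$. The determinant of a $0\times0$ matrix is $1$. -}

module Defs where

open import Level using (0ℓ)
open import Algebra.Bundles.Raw using (RawRing)
open import Data.Bool using (Bool; true; false; if_then_else_; _∨_; _∧_)
open import Data.Nat as ℕ using (ℕ; zero; suc; _∸_; ∣_-_∣; _≡ᵇ_; _<ᵇ_)
open import Data.Fin using (Fin; toℕ; punchIn)
import Data.Fin as Fin
open import Data.List using (List; []; _∷_; map)
open import Data.Integer as ℤ using (ℤ; +_; -[1+_])
open import Relation.Binary.PropositionalEquality using (_≡_)

module Over (R : RawRing 0ℓ 0ℓ) where
  open RawRing R

  sumFin : (n : ℕ) → (Fin n → Carrier) → Carrier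
  sumFin zero    f = 0#
  sumFin (suc n) f = f Fin.zero + sumFin n (λ j → f (Fin.suc j))

  sgn : ℕ → Carrier → Carrier
  sgn zero    x = x
  sgn (suc m) x = - sgn m x

  det : (n : ℕ) → (Fin n → Fin n → Carrier) → Carrier
  det zero    A = 1#
  det (suc n) A =
    sumFin (suc n) λ j →
      sgn (toℕ j) (A Fin.zero j * det n (λ r c → A (Fin.suc r) (punchIn j c)))

Mat : ℕ → ℕ → Set
Mat m n = Fin m → Fin n → ℤ

open Over ℤ.+-*-rawRing public using (sumFin) renaming (det to detℤ)

ind : Bool → ℤ
ind b = if b then + 1 else + 0

_⊗_ : ∀ {m n p} → Mat m n → Mat n p → Mat m p
_⊗_ {n = n} A B i j = sumFin n (λ l → A i l ℤ.* B l j)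

infixl 7 _⊗_

_ᵀ : ∀ {m n} → Mat m n → Mat n m
(A ᵀ) i j = A j i

idM : (n : ℕ) → Mat n n
idM n i j = ind (toℕ i ≡ᵇ toℕ j)

_⊕_ : ∀ {m n} → Mat m n → Mat m n → Mat m n
(A ⊕ B) i j = A i j ℤ.+ B i j

scal : ∀ {m n} → ℤ → Mat m n → Mat m n
scal c A i j = c ℤ.* A i j

zeroM : (m n : ℕ) → Mat m n
zeroM m n i j = + 0

Jex : (N : ℕ) → Mat N N
Jex N i j = ind (toℕ i ℕ.+ toℕ j ≡ᵇ N ∸ 1)

-- Q_N = ( J_N  I_N ), an N × 2N block matrix
Q : (N : ℕ) → Mat N (N ℕ.+ N)
Q N i j =
  if toℕ j <ᵇ N
  then ind (toℕ i ℕ.+ toℕ j ≡ᵇ N ∸ 1)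
  else ind (toℕ j ∸ N ≡ᵇ toℕ i)

σ : (m : ℕ) → ℤ → Mat m m
σ m ε i j =
  if toℕ i ≡ᵇ suc (toℕ j) then + 1
  else if (toℕ i ≡ᵇ 0) ∧ (toℕ j ≡ᵇ m ∸ 1) then ε
  else + 0

α β : (N : ℕ) → Mat N N
α N = Q N ⊗ σ (N ℕ.+ N) (+ 1) ⊗ (Q N ᵀ)
β N = Q N ⊗ σ (N ℕ.+ N) (ℤ.- (+ 1)) ⊗ (Q N ᵀ)

-- Polynomials over ℤ as coefficient lists (constant term first)

Poly : Set
Poly = List ℤ

_+ₚ_ : Poly → Poly → Poly
[]       +ₚ q        = q
(a ∷ p)  +ₚ []       = a ∷ p
(a ∷ p)  +ₚ (b ∷ q)  = (a ℤ.+ b) ∷ (p +ₚ q)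

scalₚ : ℤ → Poly → Poly
scalₚ c p = map (c ℤ.*_) p

_*ₚ_ : Poly → Poly → Poly
[]      *ₚ q = []
(a ∷ p) *ₚ q = scalₚ a q +ₚ (+ 0 ∷ (p *ₚ q))

negₚ : Poly → Poly
negₚ = map (λ a → ℤ.- a)

constₚ : ℤ → Poly
constₚ c = c ∷ []

Xₚ : Poly
Xₚ = + 0 ∷ + 1 ∷ []

polyRawRing : RawRing 0ℓ 0ℓ
polyRawRing = record
  { Carrier = Poly ; _≈_ = _≡_ ; _+_ = _+ₚ_ ; _*_ = _*ₚ_ ; -_ = negₚ
  ; 0# = [] ; 1# = constₚ (+ 1) }

detₚ : (n : ℕ) → (Fin n → Fin n → Poly) → Poly
detₚ = Over.det polyRawRing

charPoly : (n : ℕ) → Mat n n → Poly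
charPoly n A = detₚ n λ i j →
  (if toℕ i ≡ᵇ toℕ j then Xₚ else []) +ₚ negₚ (constₚ (A i j))

b : ℕ → Poly
b n = charPoly n (β n)

evalMat : (n : ℕ) → Poly → Mat n n → Mat n n
evalMat n []       A = zeroM n n
evalMat n (c ∷ cs) A = scal c (idM n) ⊕ (A ⊗ evalMat n cs A)

IMat : Set
IMat = ℕ → ℕ → ℤ

sumℕ : ℕ → (ℕ → ℤ) → ℤ
sumℕ zero    f = + 0
sumℕ (suc n) f = f n ℤ.+ sumℕ n f

γ : IMat
γ i j = ind ((∣ i - j ∣ ≡ᵇ 1) ∨ ((i ≡ᵇ 0) ∧ (j ≡ᵇ 0)))

-- the product γ·A; row i of γ vanishes outside columns 0 … i+1,
-- so the (infinite) sum over l is the finite sum over l < i+2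
γ⊗ : IMat → IMat
γ⊗ A i j = sumℕ (suc (suc i)) (λ l → γ i l ℤ.* A l j)

idI : IMat
idI i j = ind (i ≡ᵇ j)

evalγ : Poly → IMat
evalγ []       i j = + 0
evalγ (c ∷ cs) i j = c ℤ.* idI i j ℤ.+ γ⊗ (evalγ cs) i j

γ^ : ℕ → IMat
γ^ k i j = ind ((∣ i - j ∣ ≡ᵇ k) ∨ (i ℕ.+ j ≡ᵇ k ∸ 1))

restrict : (M : ℕ) → IMat → Mat M M
restrict M A i j = A (toℕ i) (toℕ j)

bαTarget : (N k i j : ℕ) → ℤ
bαTarget N k i j =
  ind ((∣ i - j ∣ ≡ᵇ k) ∨ (i ℕ.+ j ≡ᵇ k ∸ 1)
       ∨ (i ℕ.+ j ≡ᵇ 2 ℕ.* (N ∸ 1) ∸ (k ∸ 1)))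

bβTarget : (N k i j : ℕ) → ℤ
bβTarget N k i j =
  if (∣ i - j ∣ ≡ᵇ k) ∨ (i ℕ.+ j ≡ᵇ k ∸ 1) then + 1
  else if i ℕ.+ j ≡ᵇ 2 ℕ.* (N ∸ 1) ∸ (k ∸ 1) then ℤ.- (+ 1)
  else + 0

negOnePow : ℕ → ℤ
negOnePow m = -[1+ 0 ] ℤ.^ m

module Submission where

-- All matrices are described entrywise as sums of Kronecker
-- deltas δ a b over ℕ-indices.
--  * b_k(x) = det(x I - β_k) is a characteristic determinant of an almost
--    tridiagonal matrix; expanding it along the first row gives, after
--    evaluation at any matrix A, the Lucas-type recurrence
--    b_1(A) = A, b_2(A) = A² - 2I, b_{k+2}(A) = A b_{k+1}(A) - b_k(A)
--    (module PolyAction, abstract over the index set so that it applies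
--    both to α_N, β_N (index Fin N) and to the infinite γ (index ℕ)).
--  * The claimed entry patterns Γ k (for γ) and Γε (for α_N, β_N: Γ k
--    plus ε on one far anti-diagonal) satisfy the same recurrence, row by
--    row, because each row of γ, α_N, β_N has at most two neighbours
--    (plus the corner entries at 0 and N-1).  This gives the first three
--    parts; the entries of α_N, β_N themselves come from computing the
--    conjugation Q_N σ_{2N}(±1) Q_Nᵀ.
--  * For the minors of Γ k: expanding k times along the last row and then
--    k times along the last column shows det Γ|_{M+2k} = (-1)^k det Γ|_M;
--    the blocks of size < 2k are computed directly (Γ|_k is the exchange
--    matrix).

open import Defs

module Development where
  open import Data.Nat as ℕ using (ℕ; zero; suc; _≡ᵇ_; _<ᵇ_; _∸_; z≤n; s≤s; _≤_; _<_; ∣_-_∣)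
  import Data.Nat.Properties as ℕP
  import Data.Nat.Tactic.RingSolver as ℕSolver
  open import Data.Integer as ℤ using (ℤ; +_; -[1+_]; _+_; _*_; -_; _-_)
  import Data.Integer.Properties as ℤP
  open import Data.Integer.Tactic.RingSolver using (solve-∀)
  open import Data.Fin using (Fin; toℕ; punchIn; punchOut) renaming (zero to fz; suc to fs)
  import Data.Fin as Fin
  import Data.Fin.Properties as FinP
  open import Data.List using ([]; _∷_)
  open import Data.Bool using (true; false; if_then_else_; T; _∨_; _∧_)
  open import Data.Unit using (⊤; tt)
  open import Data.Empty using (⊥; ⊥-elim)
  open import Relation.Binary.PropositionalEquality
  open import Relation.Nullary using (yes; no)
  open import Data.Product using (_×_; _,_; proj₁; proj₂; Σ)
  open import Data.Sum using (_⊎_; inj₁; inj₂) renaming ([_,_] to either)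
  open import Relation.Binary.Definitions using (tri<; tri≈; tri>)
  open import Data.Nat.DivMod using (_/_; _%_; m≡m%n+[m/n]*n; m%n<n)
  open import Data.Nat.Combinatorics using (_C_; nCk+nC[k+1]≡[n+1]C[k+1]; nC1≡n)

  open Over ℤ.+-*-rawRing using (sgn)

  δ : ℕ → ℕ → ℤ
  δ a b = ind (a ≡ᵇ b)

  δ-refl : ∀ a → δ a a ≡ + 1
  δ-refl zero    = refl
  δ-refl (suc a) = δ-refl a

  δ-≡ : ∀ {a b} → a ≡ b → δ a b ≡ + 1
  δ-≡ {a} refl = δ-refl a

  δ-≢ : ∀ {a b} → a ≢ b → δ a b ≡ + 0
  δ-≢ {a} {b} a≢b with a ≡ᵇ b in eq
  ... | true  = ⊥-elim (a≢b (ℕP.≡ᵇ⇒≡ a b (subst T (sym eq) tt)))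
  ... | false = refl

  δ-sym : ∀ a b → δ a b ≡ δ b a
  δ-sym zero    zero    = refl
  δ-sym zero    (suc b) = refl
  δ-sym (suc a) zero    = refl
  δ-sym (suc a) (suc b) = δ-sym a b

  δ-cong : ∀ {a b c d} → a ≡ c → b ≡ d → δ a b ≡ δ c d
  δ-cong refl refl = refl

  δʳ : ∀ a {b c} → b ≡ c → δ a b ≡ δ a c
  δʳ a = δ-cong {a} refl

  δˡ : ∀ {a c} b → a ≡ c → δ a b ≡ δ c b
  δˡ b e = δ-cong {b = b} e refl

  δ-iff : ∀ {x y u v} → (x ≡ y → u ≡ v) → (u ≡ v → x ≡ y) → δ x y ≡ δ u v
  δ-iff {x} {y} f g with x ℕ.≟ y
  ... | yes x≡y = trans (δ-≡ x≡y) (sym (δ-≡ (f x≡y)))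
  ... | no  x≢y = trans (δ-≢ x≢y) (sym (δ-≢ (λ e → x≢y (g e))))

  δ-+ : ∀ n x y → δ (n ℕ.+ x) (n ℕ.+ y) ≡ δ x y
  δ-+ zero    x y = refl
  δ-+ (suc n) x y = δ-+ n x y

  sumFin-cong : ∀ n {f g : Fin n → ℤ} → (∀ i → f i ≡ g i) → sumFin n f ≡ sumFin n g
  sumFin-cong zero    e = refl
  sumFin-cong (suc n) e = cong₂ _+_ (e fz) (sumFin-cong n (λ i → e (fs i)))

  sumFin-+ : ∀ n (f g : Fin n → ℤ) → sumFin n (λ l → f l + g l) ≡ sumFin n f + sumFin n g
  sumFin-+ zero    f g = refl
  sumFin-+ (suc n) f g =
    trans (cong (λ z → (f fz + g fz) + z) (sumFin-+ n (λ l → f (fs l)) (λ l → g (fs l))))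
          (interchange (f fz) (g fz) _ _)
    where
    interchange : ∀ a b c d → (a + b) + (c + d) ≡ (a + c) + (b + d)
    interchange = solve-∀

  sumFin-* : ∀ n c (f : Fin n → ℤ) → sumFin n (λ l → c * f l) ≡ c * sumFin n f
  sumFin-* zero    c f = sym (ℤP.*-zeroʳ c)
  sumFin-* (suc n) c f = trans (cong (λ z → c * f fz + z) (sumFin-* n c (λ l → f (fs l))))
                               (sym (ℤP.*-distribˡ-+ c (f fz) _))

  sumFin-0 : ∀ n (f : Fin n → ℤ) → (∀ l → f l ≡ + 0) → sumFin n f ≡ + 0
  sumFin-0 zero    f z = refl
  sumFin-0 (suc n) f z = cong₂ _+_ (z fz) (sumFin-0 n (λ l → f (fs l)) (λ l → z (fs l)))

  -- ΣN n g = g 0 + … + g (n-1): a sum over a range of naturals, the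
  -- ℕ-indexed view of sumFin in which all index arithmetic is done.
  ΣN : ℕ → (ℕ → ℤ) → ℤ
  ΣN n g = sumFin n (λ l → g (toℕ l))

  ΣN-cong : ∀ n {g h : ℕ → ℤ} → (∀ l → l < n → g l ≡ h l) → ΣN n g ≡ ΣN n h
  ΣN-cong zero    e = refl
  ΣN-cong (suc n) e = cong₂ _+_ (e 0 (s≤s z≤n)) (ΣN-cong n (λ l l<n → e (suc l) (s≤s l<n)))

  ΣN-+ : ∀ n (g h : ℕ → ℤ) → ΣN n (λ l → g l + h l) ≡ ΣN n g + ΣN n h
  ΣN-+ n g h = sumFin-+ n (λ l → g (toℕ l)) (λ l → h (toℕ l))

  ΣN-* : ∀ n c (g : ℕ → ℤ) → ΣN n (λ l → c * g l) ≡ c * ΣN n g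
  ΣN-* n c g = sumFin-* n c (λ l → g (toℕ l))

  ΣN-0 : ∀ n (g : ℕ → ℤ) → (∀ l → l < n → g l ≡ + 0) → ΣN n g ≡ + 0
  ΣN-0 zero    g z = refl
  ΣN-0 (suc n) g z = cong₂ _+_ (z 0 (s≤s z≤n)) (ΣN-0 n _ (λ l l<n → z (suc l) (s≤s l<n)))

  ΣN-last : ∀ n (g : ℕ → ℤ) → ΣN (suc n) g ≡ ΣN n g + g n
  ΣN-last zero    g = ℤP.+-comm (g 0) (+ 0)
  ΣN-last (suc n) g = trans (cong (λ z → g 0 + z) (ΣN-last n (λ l → g (suc l))))
                            (sym (ℤP.+-assoc (g 0) _ _))

  ΣN-split : ∀ a b (g : ℕ → ℤ) → ΣN (a ℕ.+ b) g ≡ ΣN a g + ΣN b (λ l → g (a ℕ.+ l))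
  ΣN-split zero    b g = sym (ℤP.+-identityˡ _)
  ΣN-split (suc a) b g = trans (cong (λ z → g 0 + z) (ΣN-split a b (λ l → g (suc l))))
                               (sym (ℤP.+-assoc (g 0) _ _))

  ΣN-δ : ∀ n c (g : ℕ → ℤ) → c < n → ΣN n (λ l → δ l c * g l) ≡ g c
  ΣN-δ (suc n) zero g _ =
    trans (cong₂ _+_ (ℤP.*-identityˡ (g 0)) (ΣN-0 n _ (λ l _ → ℤP.*-zeroˡ (g (suc l)))))
          (ℤP.+-identityʳ _)
  ΣN-δ (suc n) (suc c) g (s≤s c<n) =
    trans (cong₂ _+_ (ℤP.*-zeroˡ (g 0)) (ΣN-δ n c (λ l → g (suc l)) c<n)) (ℤP.+-identityˡ _)

  ΣN-δ-out : ∀ n c (g : ℕ → ℤ) → n ≤ c → ΣN n (λ l → δ l c * g l) ≡ + 0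
  ΣN-δ-out zero    c       g _         = refl
  ΣN-δ-out (suc n) (suc c) g (s≤s n≤c) =
    cong₂ _+_ (ℤP.*-zeroˡ (g 0)) (ΣN-δ-out n c (λ l → g (suc l)) n≤c)

  -- Defs sums infinite-matrix products with sumℕ (counting downwards).
  sumℕ≡ΣN : ∀ n (g : ℕ → ℤ) → sumℕ n g ≡ ΣN n g
  sumℕ≡ΣN zero    g = refl
  sumℕ≡ΣN (suc n) g = trans (cong (λ z → g n + z) (sumℕ≡ΣN n g))
                            (trans (ℤP.+-comm (g n) _) (sym (ΣN-last n g)))

  sgn-+ : ∀ a b x → sgn (a ℕ.+ b) x ≡ sgn a (sgn b x)
  sgn-+ zero    b x = refl
  sgn-+ (suc a) b x = cong -_ (sgn-+ a b x)

  sgn-cong : ∀ {a b} x → a ≡ b → sgn a x ≡ sgn b x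
  sgn-cong x refl = refl

  sgn-double : ∀ a x → sgn (a ℕ.+ a) x ≡ x
  sgn-double zero    x = refl
  sgn-double (suc a) x = trans (sgn-cong x (cong suc (ℕP.+-suc a a)))
                               (trans (ℤP.neg-involutive _) (sgn-double a x))

  sgn-even : ∀ a b x → sgn (a ℕ.+ (b ℕ.+ b)) x ≡ sgn a x
  sgn-even a b x = trans (sgn-+ a (b ℕ.+ b) x) (cong (sgn a) (sgn-double b x))

  sgn-* : ∀ m a x → sgn m (a * x) ≡ a * sgn m x
  sgn-* zero    a x = refl
  sgn-* (suc m) a x = trans (cong -_ (sgn-* m a x)) (ℤP.neg-distribʳ-* a (sgn m x))

  sgn-distrib-+ : ∀ m x y → sgn m (x + y) ≡ sgn m x + sgn m y
  sgn-distrib-+ zero    x y = refl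
  sgn-distrib-+ (suc m) x y =
    trans (cong -_ (sgn-distrib-+ m x y)) (ℤP.neg-distrib-+ (sgn m x) (sgn m y))

  sgn-0 : ∀ m → sgn m (+ 0) ≡ + 0
  sgn-0 zero    = refl
  sgn-0 (suc m) = cong -_ (sgn-0 m)

  sgn-1 : ∀ m → sgn m (+ 1) ≡ negOnePow m
  sgn-1 zero    = refl
  sgn-1 (suc m) = trans (cong -_ (sgn-1 m)) (sym (ℤP.-1*i≡-i (negOnePow m)))

  sgn-ΣN : ∀ m n g → sgn m (ΣN n g) ≡ ΣN n (λ j → sgn m (g j))
  sgn-ΣN m zero    g = sgn-0 m
  sgn-ΣN m (suc n) g = trans (sgn-distrib-+ m (g 0) _)
                             (cong (λ z → sgn m (g 0) + z) (sgn-ΣN m n (λ j → g (suc j))))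

  sgn-nested : ∀ p q a b D → sgn p (a * sgn q (b * D)) ≡ sgn (p ℕ.+ q) (a * (b * D))
  sgn-nested p q a b D = trans (cong (sgn p) (sym (sgn-* q a (b * D)))) (sym (sgn-+ p q _))

  -- Deleting a column: skip c is the ℕ-version of punchIn

  skip : ℕ → ℕ → ℕ
  skip c x = if x <ᵇ c then x else suc x

  skip-suc : ∀ c x → skip (suc c) (suc x) ≡ suc (skip c x)
  skip-suc c x with x <ᵇ c
  ... | true  = refl
  ... | false = refl

  skip-< : ∀ {c x} → x < c → skip c x ≡ x
  skip-< {c} {x} x<c with x <ᵇ c in eq
  ... | true  = refl
  ... | false = ⊥-elim (subst T eq (ℕP.<⇒<ᵇ x<c))

  skip-≥ : ∀ {c x} → c ≤ x → skip c x ≡ suc x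
  skip-≥ {c} {x} c≤x with x <ᵇ c in eq
  ... | true  = ⊥-elim (ℕP.<⇒≱ (ℕP.<ᵇ⇒< x c (subst T (sym eq) tt)) c≤x)
  ... | false = refl

  skip-case : ∀ c x → (x < c × skip c x ≡ x) ⊎ (c ≤ x × skip c x ≡ suc x)
  skip-case c x with x ℕ.<? c
  ... | yes x<c = inj₁ (x<c , skip-< x<c)
  ... | no  x≮c = inj₂ (ℕP.≮⇒≥ x≮c , skip-≥ (ℕP.≮⇒≥ x≮c))

  skip-≢ : ∀ c x → skip c x ≢ c
  skip-≢ c x with skip-case c x
  ... | inj₁ (x<c , e) = λ e' → ℕP.<⇒≢ x<c (trans (sym e) e')
  ... | inj₂ (c≤x , e) = λ e' → ℕP.<⇒≢ (s≤s c≤x) (sym (trans (sym e) e'))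

  skip-injective : ∀ c x y → skip c x ≡ skip c y → x ≡ y
  skip-injective c x y e with skip-case c x | skip-case c y
  ... | inj₁ (_ , ex) | inj₁ (_ , ey) = trans (sym ex) (trans e ey)
  ... | inj₁ (x<c , ex) | inj₂ (c≤y , ey) =
    ⊥-elim (ℕP.<-irrefl (trans (sym ex) (trans e ey)) (ℕP.<-≤-trans x<c (ℕP.m≤n⇒m≤1+n c≤y)))
  ... | inj₂ (c≤x , ex) | inj₁ (y<c , ey) =
    ⊥-elim (ℕP.<-irrefl (trans (sym ey) (trans (sym e) ex)) (ℕP.<-≤-trans y<c (ℕP.m≤n⇒m≤1+n c≤x)))
  ... | inj₂ (_ , ex) | inj₂ (_ , ey) = ℕP.suc-injective (trans (sym ex) (trans e ey))

  skip-≤ : ∀ c x n → x ≤ n → skip c x ≤ suc n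
  skip-≤ c x n x≤n with skip-case c x
  ... | inj₁ (_ , e) = subst (_≤ suc n) (sym e) (ℕP.m≤n⇒m≤1+n x≤n)
  ... | inj₂ (_ , e) = subst (_≤ suc n) (sym e) (s≤s x≤n)

  skip-≥-self : ∀ c y → y ≤ skip c y
  skip-≥-self c y with skip-case c y
  ... | inj₁ (_ , e) = ℕP.≤-reflexive (sym e)
  ... | inj₂ (_ , e) = subst (y ≤_) (sym e) (ℕP.n≤1+n y)

  skip-≤-suc : ∀ c y → skip c y ≤ suc y
  skip-≤-suc c y with skip-case c y
  ... | inj₁ (_ , e) = subst (_≤ suc y) (sym e) (ℕP.n≤1+n y)
  ... | inj₂ (_ , e) = ℕP.≤-reflexive e

  skip-commute : ∀ {c j} → c ≤ j → ∀ y → skip (suc j) (skip c y) ≡ skip c (skip j y)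
  skip-commute {c} {j} c≤j y with skip-case c y
  ... | inj₁ (y<c , e) = begin
        skip (suc j) (skip c y) ≡⟨ cong (skip (suc j)) e ⟩
        skip (suc j) y          ≡⟨ skip-< (ℕP.<-≤-trans y<c (ℕP.m≤n⇒m≤1+n c≤j)) ⟩
        y                       ≡⟨ sym e ⟩
        skip c y                ≡⟨ cong (skip c) (sym (skip-< (ℕP.<-≤-trans y<c c≤j))) ⟩
        skip c (skip j y)       ∎
    where open ≡-Reasoning
  ... | inj₂ (c≤y , e) = begin
        skip (suc j) (skip c y) ≡⟨ cong (skip (suc j)) e ⟩
        skip (suc j) (suc y)    ≡⟨ skip-suc j y ⟩
        suc (skip j y)          ≡⟨ sym (skip-≥ (ℕP.≤-trans c≤y (skip-≥-self j y))) ⟩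
        skip c (skip j y)       ∎
    where open ≡-Reasoning

  skip-commute′ : ∀ {j c} → j ≤ c → ∀ y → skip j (skip c y) ≡ skip (suc c) (skip j y)
  skip-commute′ {j} {c} j≤c y with skip-case c y
  ... | inj₁ (y<c , e) = begin
        skip j (skip c y)       ≡⟨ cong (skip j) e ⟩
        skip j y                ≡⟨ sym (skip-< (s≤s (ℕP.≤-trans (skip-≤-suc j y) y<c))) ⟩
        skip (suc c) (skip j y) ∎
    where open ≡-Reasoning
  ... | inj₂ (c≤y , e) = begin
        skip j (skip c y)       ≡⟨ cong (skip j) e ⟩
        skip j (suc y)          ≡⟨ skip-≥ (ℕP.m≤n⇒m≤1+n (ℕP.≤-trans j≤c c≤y)) ⟩
        suc (suc y)             ≡⟨ cong suc (sym e) ⟩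
        suc (skip c y)          ≡⟨ sym (skip-suc c y) ⟩
        skip (suc c) (suc y)    ≡⟨ cong (skip (suc c)) (sym (skip-≥ (ℕP.≤-trans j≤c c≤y))) ⟩
        skip (suc c) (skip j y) ∎
    where open ≡-Reasoning

  -- Deleting column c and then column j of what is left is the same as
  -- deleting first column s = skip c j and then the column col that c
  -- occupies in the remaining matrix; the Laplace signs of the two orders
  -- differ by one, recorded as  s + col ≡ c + j + 1  modulo 2.
  record SkipSwap (c j : ℕ) : Set where
    field
      col     : ℕ
      col≤    : ∀ n → c ≤ suc n → j ≤ n → col ≤ n
      lands   : skip (skip c j) col ≡ c
      commute : ∀ y → skip (skip c j) (skip col y) ≡ skip c (skip j y)
      half    : ℕ
      parity  : skip c j ℕ.+ col ℕ.+ (half ℕ.+ half) ≡ suc (c ℕ.+ j)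

  skip-swap : ∀ c j → SkipSwap c j
  skip-swap c j with skip-case c j
  ... | inj₂ (c≤j , s≡) = record
    { col     = c
    ; col≤    = λ _ _ j≤n → ℕP.≤-trans c≤j j≤n
    ; lands   = trans (cong (λ s → skip s c) s≡) (skip-< (s≤s c≤j))
    ; commute = λ y → trans (cong (λ s → skip s (skip c y)) s≡) (skip-commute c≤j y)
    ; half    = 0
    ; parity  = trans (cong (λ s → s ℕ.+ c ℕ.+ 0) s≡) (cong suc (+0-comm j c))
    }
    where
    +0-comm : ∀ j c → j ℕ.+ c ℕ.+ 0 ≡ c ℕ.+ j
    +0-comm = ℕSolver.solve-∀
  skip-swap (suc c) j | inj₁ (s≤s j≤c , s≡) = record
    { col     = c
    ; col≤    = λ _ c≤ _ → ℕP.≤-pred c≤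
    ; lands   = trans (cong (λ s → skip s c) s≡) (skip-≥ j≤c)
    ; commute = λ y → trans (cong (λ s → skip s (skip c y)) s≡) (skip-commute′ j≤c y)
    ; half    = 1
    ; parity  = trans (cong (λ s → s ℕ.+ c ℕ.+ 2) s≡) (+2-comm j c)
    }
    where
    +2-comm : ∀ j c → j ℕ.+ c ℕ.+ 2 ≡ suc (suc (c ℕ.+ j))
    +2-comm = ℕSolver.solve-∀

  ΣN-skip : ∀ n c (g : ℕ → ℤ) → c ≤ n → ΣN (suc n) g ≡ g c + ΣN n (λ j → g (skip c j))
  ΣN-skip n       zero    g _         = refl
  ΣN-skip (suc n) (suc c) g (s≤s c≤n) = begin
      g 0 + ΣN (suc n) (λ l → g (suc l))
    ≡⟨ cong (λ z → g 0 + z) (ΣN-skip n c (λ l → g (suc l)) c≤n) ⟩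
      g 0 + (g (suc c) + ΣN n (λ j → g (suc (skip c j))))
    ≡⟨ cong (λ z → g 0 + (g (suc c) + z)) (ΣN-cong n (λ j _ → cong g (sym (skip-suc c j)))) ⟩
      g 0 + (g (suc c) + ΣN n (λ j → g (skip (suc c) (suc j))))
    ≡⟨ left-comm (g 0) (g (suc c)) _ ⟩
      g (suc c) + (g 0 + ΣN n (λ j → g (skip (suc c) (suc j)))) ∎
    where
    open ≡-Reasoning
    left-comm : ∀ a b d → a + (b + d) ≡ b + (a + d)
    left-comm = solve-∀

  detN : (n : ℕ) → (ℕ → ℕ → ℤ) → ℤ
  detN n F = detℤ n (λ i j → F (toℕ i) (toℕ j))

  detℤ-cong : ∀ n {A B : Fin n → Fin n → ℤ} → (∀ i j → A i j ≡ B i j) → detℤ n A ≡ detℤ n B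
  detℤ-cong zero    e = refl
  detℤ-cong (suc n) e = sumFin-cong (suc n) (λ j →
    cong (sgn (toℕ j)) (cong₂ _*_ (e fz j) (detℤ-cong n (λ r c → e (fs r) (punchIn j c)))))

  detN-cong : ∀ n {F G : ℕ → ℕ → ℤ} → (∀ i j → i < n → j < n → F i j ≡ G i j) →
              detN n F ≡ detN n G
  detN-cong n e = detℤ-cong n (λ i j → e (toℕ i) (toℕ j) (FinP.toℕ<n i) (FinP.toℕ<n j))

  toℕ-punchIn : ∀ {n} (j : Fin (suc n)) (c : Fin n) → toℕ (punchIn j c) ≡ skip (toℕ j) (toℕ c)
  toℕ-punchIn fz     c      = refl
  toℕ-punchIn (fs j) fz     = refl
  toℕ-punchIn (fs j) (fs c) = trans (cong suc (toℕ-punchIn j c)) (sym (skip-suc (toℕ j) (toℕ c)))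

  detN-expand : ∀ n F → detN (suc n) F ≡
    ΣN (suc n) (λ j → sgn j (F 0 j * detN n (λ r c → F (suc r) (skip j c))))
  detN-expand n F = sumFin-cong (suc n) (λ j → cong (sgn (toℕ j)) (cong (F 0 (toℕ j) *_)
    (detℤ-cong n (λ r c → cong (F (suc (toℕ r))) (toℕ-punchIn j c)))))

  sgn-zero-* : ∀ m {a} D → a ≡ + 0 → sgn m (a * D) ≡ + 0
  sgn-zero-* m D refl = sgn-0 m

  detN-zeroRow0 : ∀ n F → (∀ j → j < suc n → F 0 j ≡ + 0) → detN (suc n) F ≡ + 0
  detN-zeroRow0 n F z = trans (detN-expand n F)
    (ΣN-0 (suc n) _ (λ j j< → sgn-zero-* j (detN n (λ r c → F (suc r) (skip j c))) (z j j<)))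

  LastRowExpansion : ℕ → Set
  LastRowExpansion n = ∀ (F : ℕ → ℕ → ℤ) c → c ≤ n → (∀ j → j ≤ n → j ≢ c → F n j ≡ + 0) →
                       detN (suc n) F ≡ sgn (n ℕ.+ c) (F n c * detN n (λ i j → F i (skip c j)))

  -- The induction step, for a matrix F of size n+2 whose last row has its
  -- only nonzero entry at c: in the row-0 expansion the term at column c
  -- vanishes, and every other minor is expanded along its last row.
  module LastRowStep (n : ℕ) (IH : LastRowExpansion n) (F : ℕ → ℕ → ℤ) (c : ℕ) (c≤ : c ≤ suc n)
                     (hz : ∀ j → j ≤ suc n → j ≢ c → F (suc n) j ≡ + 0) where
    minor : ℕ → ℕ → ℕ → ℤ
    minor j r x = F (suc r) (skip j x)

    term : ℕ → ℤ
    term j = sgn j (F 0 j * detN (suc n) (minor j))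

    -- the minor at column c has a zero last row
    term-c : term c ≡ + 0
    term-c = trans (cong (λ w → sgn c (F 0 c * w))
                     (trans (IH (minor c) 0 z≤n (λ x x≤ _ → row-zero x x≤))
                            (sgn-zero-* (n ℕ.+ 0) _ (row-zero 0 z≤n))))
                   (trans (cong (sgn c) (ℤP.*-zeroʳ (F 0 c))) (sgn-0 c))
      where
      row-zero : ∀ x → x ≤ n → minor c n x ≡ + 0
      row-zero x x≤ = hz (skip c x) (skip-≤ c x n x≤) (skip-≢ c x)

    term-skip : ∀ j → j ≤ n → term (skip c j)
      ≡ sgn (suc n ℕ.+ c) (F (suc n) c * sgn j (F 0 (skip c j) * detN n (λ r y → F (suc r) (skip c (skip j y)))))
    term-skip j j≤n = begin
        sgn s (F 0 s * detN (suc n) (minor s))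
      ≡⟨ cong (λ w → sgn s (F 0 s * w)) (IH (minor s) col (col≤ n c≤ j≤n) row-zero) ⟩
        sgn s (F 0 s * sgn (n ℕ.+ col) (F (suc n) (skip s col) * detN n (λ i y → F (suc i) (skip s (skip col y)))))
      ≡⟨ cong₂ (λ u v → sgn s (F 0 s * sgn (n ℕ.+ col) (F (suc n) u * v))) lands
           (detN-cong n (λ i y _ _ → cong (F (suc i)) (commute y))) ⟩
        sgn s (F 0 s * sgn (n ℕ.+ col) (F (suc n) c * D))
      ≡⟨ sgn-nested s (n ℕ.+ col) (F 0 s) (F (suc n) c) D ⟩
        sgn (s ℕ.+ (n ℕ.+ col)) (F 0 s * (F (suc n) c * D))
      ≡⟨ cong (sgn (s ℕ.+ (n ℕ.+ col))) (swap (F 0 s) (F (suc n) c) D) ⟩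
        sgn (s ℕ.+ (n ℕ.+ col)) (F (suc n) c * (F 0 s * D))
      ≡⟨ same-parity (F (suc n) c * (F 0 s * D)) ⟩
        sgn (suc n ℕ.+ c ℕ.+ j) (F (suc n) c * (F 0 s * D))
      ≡⟨ sym (sgn-nested (suc n ℕ.+ c) j (F (suc n) c) (F 0 s) D) ⟩
        sgn (suc n ℕ.+ c) (F (suc n) c * sgn j (F 0 s * D)) ∎
      where
      open ≡-Reasoning
      open SkipSwap (skip-swap c j)
      s = skip c j
      D = detN n (λ r y → F (suc r) (skip c (skip j y)))
      row-zero : ∀ x → x ≤ n → x ≢ col → minor s n x ≡ + 0
      row-zero x x≤ x≢ = hz (skip s x) (skip-≤ s x n x≤)
                            (λ e → x≢ (skip-injective s x col (trans e (sym lands))))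
      swap : ∀ a b d → a * (b * d) ≡ b * (a * d)
      swap = solve-∀
      regroup : ∀ s n col h → s ℕ.+ (n ℕ.+ col) ℕ.+ (h ℕ.+ h) ≡ n ℕ.+ (s ℕ.+ col ℕ.+ (h ℕ.+ h))
      regroup = ℕSolver.solve-∀
      shift : ∀ n c j → n ℕ.+ suc (c ℕ.+ j) ≡ suc n ℕ.+ c ℕ.+ j
      shift = ℕSolver.solve-∀
      same-parity : ∀ x → sgn (s ℕ.+ (n ℕ.+ col)) x ≡ sgn (suc n ℕ.+ c ℕ.+ j) x
      same-parity x = trans (sym (sgn-even (s ℕ.+ (n ℕ.+ col)) half x))
        (sgn-cong x (trans (regroup s n col half) (trans (cong (n ℕ.+_) parity) (shift n c j))))

  detN-lastRow : ∀ n → LastRowExpansion n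
  detN-lastRow zero    F zero _  _  = ℤP.+-identityʳ _
  detN-lastRow (suc n) F c    c≤ hz = begin
      detN (suc (suc n)) F
    ≡⟨ detN-expand (suc n) F ⟩
      ΣN (suc (suc n)) term
    ≡⟨ ΣN-skip (suc n) c term c≤ ⟩
      term c + ΣN (suc n) (λ j → term (skip c j))
    ≡⟨ cong₂ _+_ term-c (ΣN-cong (suc n) (λ j j< → term-skip j (ℕP.≤-pred j<))) ⟩
      + 0 + ΣN (suc n) (λ j → sgn E (F (suc n) c * g j))
    ≡⟨ ℤP.+-identityˡ _ ⟩
      ΣN (suc n) (λ j → sgn E (F (suc n) c * g j))
    ≡⟨ sym (sgn-ΣN E (suc n) (λ j → F (suc n) c * g j)) ⟩
      sgn E (ΣN (suc n) (λ j → F (suc n) c * g j))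
    ≡⟨ cong (sgn E) (ΣN-* (suc n) (F (suc n) c) g) ⟩
      sgn E (F (suc n) c * ΣN (suc n) g)
    ≡⟨ cong (λ w → sgn E (F (suc n) c * w)) (sym (detN-expand n (λ i j → F i (skip c j)))) ⟩
      sgn E (F (suc n) c * detN (suc n) (λ i j → F i (skip c j))) ∎
    where
    open ≡-Reasoning
    open LastRowStep n (detN-lastRow n) F c c≤ hz
    E : ℕ
    E = suc n ℕ.+ c
    g : ℕ → ℤ
    g j = sgn j (F 0 (skip c j) * detN n (λ r y → F (suc r) (skip c (skip j y))))

  detN-lastCol : ∀ n (F : ℕ → ℕ → ℤ) → (∀ i → i < n → F i n ≡ + 0) →
                 detN (suc n) F ≡ F n n * detN n F
  detN-lastCol zero    F _  = ℤP.+-identityʳ _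
  detN-lastCol (suc n) F hz = begin
      detN (suc (suc n)) F
    ≡⟨ detN-expand (suc n) F ⟩
      ΣN (suc (suc n)) h
    ≡⟨ ΣN-last (suc n) h ⟩
      ΣN (suc n) h + h (suc n)
    ≡⟨ cong₂ _+_ (ΣN-cong (suc n) (λ j j< → h-inner j (ℕP.≤-pred j<))) h-last ⟩
      ΣN (suc n) (λ j → F (suc n) (suc n) * g j) + + 0
    ≡⟨ ℤP.+-identityʳ _ ⟩
      ΣN (suc n) (λ j → F (suc n) (suc n) * g j)
    ≡⟨ ΣN-* (suc n) (F (suc n) (suc n)) g ⟩
      F (suc n) (suc n) * ΣN (suc n) g
    ≡⟨ cong (F (suc n) (suc n) *_) (sym (detN-expand n F)) ⟩
      F (suc n) (suc n) * detN (suc n) F ∎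
    where
    open ≡-Reasoning
    minor : ℕ → ℕ → ℕ → ℤ
    minor j r x = F (suc r) (skip j x)
    h : ℕ → ℤ
    h j = sgn j (F 0 j * detN (suc n) (minor j))
    g : ℕ → ℤ
    g j = sgn j (F 0 j * detN n (minor j))
    h-last : h (suc n) ≡ + 0
    h-last = sgn-zero-* (suc n) (detN (suc n) (minor (suc n))) (hz 0 (s≤s z≤n))
    swap : ∀ a b d → a * (b * d) ≡ b * (a * d)
    swap = solve-∀
    h-inner : ∀ j → j ≤ n → h j ≡ F (suc n) (suc n) * g j
    h-inner j j≤n = begin
        sgn j (F 0 j * detN (suc n) (minor j))
      ≡⟨ cong (λ w → sgn j (F 0 j * w)) (detN-lastCol n (minor j)
            (λ i i<n → trans (cong (F (suc i)) (skip-≥ j≤n)) (hz (suc i) (s≤s i<n)))) ⟩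
        sgn j (F 0 j * (F (suc n) (skip j n) * detN n (minor j)))
      ≡⟨ cong (λ w → sgn j (F 0 j * (F (suc n) w * detN n (minor j)))) (skip-≥ j≤n) ⟩
        sgn j (F 0 j * (F (suc n) (suc n) * detN n (minor j)))
      ≡⟨ cong (sgn j) (swap (F 0 j) (F (suc n) (suc n)) (detN n (minor j))) ⟩
        sgn j (F (suc n) (suc n) * (F 0 j * detN n (minor j)))
      ≡⟨ sgn-* j (F (suc n) (suc n)) (F 0 j * detN n (minor j)) ⟩
        F (suc n) (suc n) * g j ∎

  detN-exchange : ∀ m → detN m (λ i j → δ (suc (i ℕ.+ j)) m) ≡ sgn (m C 2) (+ 1)
  detN-exchange zero    = refl
  detN-exchange (suc m) = begin
      detN (suc m) F
    ≡⟨ detN-lastRow m F 0 z≤n (λ j _ j≢0 → δ-≢ (λ e → j≢0 (ℕP.+-cancelˡ-≡ m j 0 (trans e (sym (ℕP.+-identityʳ m)))))) ⟩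
      sgn (m ℕ.+ 0) (F m 0 * detN m (λ i j → F i (skip 0 j)))
    ≡⟨ cong₂ (λ u v → sgn (m ℕ.+ 0) (u * v)) (δ-≡ (ℕP.+-identityʳ m))
         (trans (detN-cong m (λ i j _ _ → δˡ m (ℕP.+-suc i j))) (detN-exchange m)) ⟩
      sgn (m ℕ.+ 0) (+ 1 * sgn (m C 2) (+ 1))
    ≡⟨ cong (sgn (m ℕ.+ 0)) (ℤP.*-identityˡ _) ⟩
      sgn (m ℕ.+ 0) (sgn (m C 2) (+ 1))
    ≡⟨ sym (sgn-+ (m ℕ.+ 0) (m C 2) (+ 1)) ⟩
      sgn (m ℕ.+ 0 ℕ.+ m C 2) (+ 1)
    ≡⟨ sgn-cong (+ 1) pascal ⟩
      sgn (suc m C 2) (+ 1) ∎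
    where
    open ≡-Reasoning
    F : ℕ → ℕ → ℤ
    F i j = δ (suc (i ℕ.+ j)) (suc m)
    pascal : m ℕ.+ 0 ℕ.+ m C 2 ≡ suc m C 2
    pascal = trans (cong (ℕ._+ m C 2) (trans (ℕP.+-identityʳ m) (sym (nC1≡n m))))
                   (nCk+nC[k+1]≡[n+1]C[k+1] m 1)

  -- Entries of α_N and β_N

  Qf : ℕ → ℕ → ℕ → ℤ
  Qf N a m = if m <ᵇ N then ind (a ℕ.+ m ≡ᵇ N ∸ 1) else ind (m ∸ N ≡ᵇ a)

  σf : ℕ → ℤ → ℕ → ℕ → ℤ
  σf m ε l c = if l ≡ᵇ suc c then + 1 else if (l ≡ᵇ 0) ∧ (c ≡ᵇ m ∸ 1) then ε else + 0

  -- γ|_N with ε added to its last diagonal entry (ℕ-indexed).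
  Sε : ℤ → ℕ → ℕ → ℕ → ℤ
  Sε ε N a b = δ b (suc a) + δ a (suc b) + δ a 0 * δ b 0 + ε * (δ (suc a) N * δ (suc b) N)

  Qf-lo : ∀ N a l → l < N → Qf N a l ≡ δ (a ℕ.+ l) (N ∸ 1)
  Qf-lo N a l l<N with l <ᵇ N in eq
  ... | true  = refl
  ... | false = ⊥-elim (subst T eq (ℕP.<⇒<ᵇ l<N))

  Qf-hi : ∀ N a l → Qf N a (N ℕ.+ l) ≡ δ l a
  Qf-hi N a l with (N ℕ.+ l) <ᵇ N in eq
  ... | true  = ⊥-elim (ℕP.<⇒≱ (ℕP.<ᵇ⇒< (N ℕ.+ l) N (subst T (sym eq) tt)) (ℕP.m≤m+n N l))
  ... | false = δˡ a (ℕP.m+n∸m≡n N l)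

  ΣQ : ∀ N a p (g : ℕ → ℤ) → a ℕ.+ p ≡ N ∸ 1 → a < N →
       ΣN (N ℕ.+ N) (λ l → Qf N a l * g l) ≡ g p + g (N ℕ.+ a)
  ΣQ (suc n) a p g e a<N = begin
      ΣN (N ℕ.+ N) (λ l → Qf N a l * g l)
    ≡⟨ ΣN-split N N (λ l → Qf N a l * g l) ⟩
      ΣN N (λ l → Qf N a l * g l) + ΣN N (λ l → Qf N a (N ℕ.+ l) * g (N ℕ.+ l))
    ≡⟨ cong₂ _+_ (ΣN-cong N (λ l l<N → cong (_* g l) (trans (Qf-lo N a l l<N) (δ-iff cancel (λ { refl → e })))))
                 (ΣN-cong N (λ l _ → cong (_* g (N ℕ.+ l)) (Qf-hi N a l))) ⟩
      ΣN N (λ l → δ l p * g l) + ΣN N (λ l → δ l a * g (N ℕ.+ l))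
    ≡⟨ cong₂ _+_ (ΣN-δ N p g p<N) (ΣN-δ N a (λ l → g (N ℕ.+ l)) a<N) ⟩
      g p + g (N ℕ.+ a) ∎
    where
    open ≡-Reasoning
    N = suc n
    cancel : ∀ {l} → a ℕ.+ l ≡ n → l ≡ p
    cancel e' = ℕP.+-cancelˡ-≡ a _ _ (trans e' (sym e))
    p<N : p < N
    p<N = s≤s (subst (p ≤_) e (ℕP.m≤n+m p a))

  -- Conjugating by Q_N folds a 2N × 2N matrix M onto an N × N one: the
  -- (a,b) entry is the sum of the four entries of M at the reflected
  -- positions N-1-a or N+a, and N-1-b or N+b.
  conj-Q : ∀ n (M : ℕ → ℕ → ℤ) (i j : Fin (suc n)) →
    let N = suc n ; a = toℕ i ; c = toℕ j ; p = n ∸ a ; q = n ∸ c in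
    (Q N ⊗ (λ x y → M (toℕ x) (toℕ y)) ⊗ (Q N ᵀ)) i j
      ≡ (M p q + M (N ℕ.+ a) q) + (M p (N ℕ.+ c) + M (N ℕ.+ a) (N ℕ.+ c))
  conj-Q n M i j = begin
      ΣN (N ℕ.+ N) (λ m → row m * Qf N c m)
    ≡⟨ ΣN-cong (N ℕ.+ N) (λ m _ → ℤP.*-comm (row m) (Qf N c m)) ⟩
      ΣN (N ℕ.+ N) (λ m → Qf N c m * row m)
    ≡⟨ ΣQ N c q row (ℕP.m+[n∸m]≡n (ℕP.≤-pred (FinP.toℕ<n j))) (FinP.toℕ<n j) ⟩
      row q + row (N ℕ.+ c)
    ≡⟨ cong₂ _+_ (ΣQ N a p (λ l → M l q) ep a<N) (ΣQ N a p (λ l → M l (N ℕ.+ c)) ep a<N) ⟩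
      (M p q + M (N ℕ.+ a) q) + (M p (N ℕ.+ c) + M (N ℕ.+ a) (N ℕ.+ c)) ∎
    where
    open ≡-Reasoning
    N = suc n
    a = toℕ i
    c = toℕ j
    p = n ∸ a
    q = n ∸ c
    a<N = FinP.toℕ<n i
    ep : a ℕ.+ p ≡ n
    ep = ℕP.m+[n∸m]≡n (ℕP.≤-pred a<N)
    row : ℕ → ℤ
    row m = ΣN (N ℕ.+ N) (λ l → Qf N a l * M l m)

  σf-δ : ∀ m ε l c → σf m ε l c ≡ δ l (suc c) + ε * (δ l 0 * δ c (m ∸ 1))
  σf-δ m ε zero c with c ≡ᵇ m ∸ 1
  ... | true  = unit ε
    where
    unit : ∀ e → e ≡ + 0 + e * (+ 1 * + 1)
    unit = solve-∀
  ... | false = sym (cong (λ z → + 0 + z) (ℤP.*-zeroʳ ε))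
  σf-δ m ε (suc l) c with l ≡ᵇ c
  ... | true  = sym (cong (λ z → + 1 + z) (trans (cong (ε *_) (ℤP.*-zeroˡ (δ c (m ∸ 1)))) (ℤP.*-zeroʳ ε)))
  ... | false = sym (cong (λ z → + 0 + z) (trans (cong (ε *_) (ℤP.*-zeroˡ (δ c (m ∸ 1)))) (ℤP.*-zeroʳ ε)))

  module Reflected (n a b p q : ℕ) (ep : a ℕ.+ p ≡ n) (eq : b ℕ.+ q ≡ n) where
    q≤n : q ≤ n
    q≤n = subst (q ≤_) eq (ℕP.m≤n+m q b)
    p≤n : p ≤ n
    p≤n = subst (p ≤_) ep (ℕP.m≤n+m p a)

    sub-sub : δ p (suc q) ≡ δ b (suc a)
    sub-sub = δ-iff
      (λ e → ℕP.+-cancelʳ-≡ q b (suc a) (trans eq (trans (sym ep) (trans (cong (a ℕ.+_) e) (ℕP.+-suc a q)))))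
      (λ e → ℕP.+-cancelˡ-≡ a p (suc q) (trans ep (trans (sym eq) (trans (cong (ℕ._+ q) e) (sym (ℕP.+-suc a q))))))
    sub-corner : δ q (n ℕ.+ suc n) ≡ + 0
    sub-corner = δ-≢ (ℕP.<⇒≢ (ℕP.≤-<-trans q≤n (ℕP.m<m+n n (s≤s z≤n))))
    super-sub : δ (n ℕ.+ a) q ≡ δ a 0 * δ b 0
    super-sub with a ℕ.≟ 0 | b ℕ.≟ 0
    ... | yes refl | yes refl = δ-≡ (trans (ℕP.+-identityʳ n) (sym eq))
    ... | yes refl | no b≢0   = trans (δ-≢ (λ e → b≢0 (ℕP.+-cancelʳ-≡ q b 0 (trans eq (trans (sym (ℕP.+-identityʳ n)) e)))))
                                      (sym (trans (cong (δ 0 0 *_) (δ-≢ b≢0)) (ℤP.*-zeroʳ (δ 0 0))))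
    ... | no a≢0   | _        = trans (δ-≢ (λ e → ℕP.<-irrefl (sym e) (ℕP.≤-<-trans q≤n (ℕP.m<m+n n (ℕP.n≢0⇒n>0 a≢0)))))
                                      (sym (trans (cong (_* δ b 0) (δ-≢ a≢0)) (ℤP.*-zeroˡ (δ b 0))))
    sub-super : δ p (suc (suc n ℕ.+ b)) ≡ + 0
    sub-super = δ-≢ (ℕP.<⇒≢ (ℕP.≤-<-trans p≤n (ℕP.<-trans (ℕP.n<1+n n) (s≤s (s≤s (ℕP.m≤m+n n b))))))
    sub-top : δ p 0 ≡ δ a n
    sub-top = δ-iff (λ e → trans (sym (ℕP.+-identityʳ a)) (trans (cong (a ℕ.+_) (sym e)) ep))
                    (λ e → ℕP.+-cancelˡ-≡ a p 0 (trans ep (trans (sym e) (sym (ℕP.+-identityʳ a)))))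
    super-corner : δ (suc n ℕ.+ b) (n ℕ.+ suc n) ≡ δ b n
    super-corner = trans (δʳ (suc n ℕ.+ b) (ℕP.+-suc n n)) (δ-+ n b n)
    super-super : δ (suc n ℕ.+ a) (suc (suc n ℕ.+ b)) ≡ δ a (suc b)
    super-super = trans (δʳ (n ℕ.+ a) (sym (ℕP.+-suc n b))) (δ-+ n a (suc b))

  Qσ-entries : ∀ N ε (i j : Fin N) → (Q N ⊗ σ (N ℕ.+ N) ε ⊗ (Q N ᵀ)) i j ≡ Sε ε N (toℕ i) (toℕ j)
  Qσ-entries (suc n) ε i j = begin
      (Q N ⊗ σ (N ℕ.+ N) ε ⊗ (Q N ᵀ)) i j
    ≡⟨ conj-Q n (σf M ε) i j ⟩
      (σf M ε p q + σf M ε (N ℕ.+ a) q) + (σf M ε p (N ℕ.+ c) + σf M ε (N ℕ.+ a) (N ℕ.+ c))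
    ≡⟨ cong₂ _+_ (cong₂ _+_ (σf-δ M ε p q) (σf-δ M ε (N ℕ.+ a) q))
                 (cong₂ _+_ (σf-δ M ε p (N ℕ.+ c)) (σf-δ M ε (N ℕ.+ a) (N ℕ.+ c))) ⟩
      shape (δ p (suc q)) (δ q K) (δ (n ℕ.+ a) q) (δ p (suc (N ℕ.+ c))) (δ p 0) (δ (N ℕ.+ c) K)
            (δ (N ℕ.+ a) (suc (N ℕ.+ c)))
    ≡⟨ shape-cong R.sub-sub R.sub-corner R.super-sub R.sub-super R.sub-top R.super-corner R.super-super ⟩
      shape (δ c (suc a)) (+ 0) (δ a 0 * δ c 0) (+ 0) (δ a n) (δ c n) (δ a (suc c))
    ≡⟨ collect (δ c (suc a)) (δ a (suc c)) (δ a 0 * δ c 0) ε (δ a n) (δ c n) ⟩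
      Sε ε N a c ∎
    where
    open ≡-Reasoning
    N = suc n
    M = N ℕ.+ N
    K = n ℕ.+ suc n
    a = toℕ i
    c = toℕ j
    p = n ∸ a
    q = n ∸ c
    module R = Reflected n a c p q (ℕP.m+[n∸m]≡n (ℕP.≤-pred (FinP.toℕ<n i)))
                                   (ℕP.m+[n∸m]≡n (ℕP.≤-pred (FinP.toℕ<n j)))
    shape : ℤ → ℤ → ℤ → ℤ → ℤ → ℤ → ℤ → ℤ
    shape pq qK aq pb p0 bK ab =
      ((pq + ε * (p0 * qK)) + (aq + ε * (+ 0 * qK))) + ((pb + ε * (p0 * bK)) + (ab + ε * (+ 0 * bK)))
    shape-cong : ∀ {x₁ x₂ x₃ x₄ x₅ x₆ x₇ y₁ y₂ y₃ y₄ y₅ y₆ y₇} →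
      x₁ ≡ y₁ → x₂ ≡ y₂ → x₃ ≡ y₃ → x₄ ≡ y₄ → x₅ ≡ y₅ → x₆ ≡ y₆ → x₇ ≡ y₇ →
      shape x₁ x₂ x₃ x₄ x₅ x₆ x₇ ≡ shape y₁ y₂ y₃ y₄ y₅ y₆ y₇
    shape-cong refl refl refl refl refl refl refl = refl
    collect : ∀ x y z e u v → ((x + e * (u * + 0)) + (z + e * (+ 0 * + 0)))
                              + ((+ 0 + e * (u * v)) + (y + e * (+ 0 * v)))
                              ≡ x + y + z + e * (u * v)
    collect = solve-∀

  module OP = Over polyRawRing

  AllZero : Poly → Set
  AllZero []      = ⊤
  AllZero (a ∷ p) = (a ≡ + 0) × AllZero p

  sumₚ-cong : ∀ m {f g : Fin m → Poly} → (∀ j → f j ≡ g j) → OP.sumFin m f ≡ OP.sumFin m g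
  sumₚ-cong zero    e = refl
  sumₚ-cong (suc m) e = cong₂ _+ₚ_ (e fz) (sumₚ-cong m (λ j → e (fs j)))

  detₚ-cong : ∀ n {A B : Fin n → Fin n → Poly} → (∀ i j → A i j ≡ B i j) → detₚ n A ≡ detₚ n B
  detₚ-cong zero    e = refl
  detₚ-cong (suc n) e = sumₚ-cong (suc n) (λ j → cong (OP.sgn (toℕ j))
     (cong₂ _*ₚ_ (e fz j) (detₚ-cong n (λ r c → e (fs r) (punchIn j c)))))

  charEntry : (ℕ → ℕ → ℤ) → ℕ → ℕ → Poly
  charEntry S i j = (if i ≡ᵇ j then Xₚ else []) +ₚ negₚ (constₚ (S i j))

  charDet : ℕ → (ℕ → ℕ → ℤ) → Poly
  charDet n S = detₚ n (λ i j → charEntry S (toℕ i) (toℕ j))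

  charDet-cong : ∀ n {S S′ : ℕ → ℕ → ℤ} → (∀ i j → S i j ≡ S′ i j) → charDet n S ≡ charDet n S′
  charDet-cong n e = detₚ-cong n (λ i j → cong (λ z → (if toℕ i ≡ᵇ toℕ j then Xₚ else []) +ₚ negₚ (constₚ z))
                                               (e (toℕ i) (toℕ j)))

  shift : (ℕ → ℕ → ℤ) → ℕ → ℕ → ℤ
  shift S i j = S (suc i) (suc j)

  βcore : ℕ → ℕ → ℕ → ℤ
  βcore m i j = δ j (suc i) + δ i (suc j) - δ (suc i) m * δ (suc j) m

  βδ : ℕ → ℕ → ℕ → ℤ
  βδ m i j = βcore m i j + δ i 0 * δ j 0

  β-entries : ∀ N (i j : Fin N) → β N i j ≡ βδ N (toℕ i) (toℕ j)
  β-entries N i j = trans (Qσ-entries N (- + 1) i j)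
    (reorder (δ (toℕ j) (suc (toℕ i))) (δ (toℕ i) (suc (toℕ j))) (δ (toℕ i) 0 * δ (toℕ j) 0)
             (δ (suc (toℕ i)) N * δ (suc (toℕ j)) N))
    where
    reorder : ∀ x y z w → x + y + z + (- + 1) * w ≡ x + y - w + z
    reorder = solve-∀

  b≡charDet : ∀ k → b k ≡ charDet k (βδ k)
  b≡charDet k = detₚ-cong k (λ i j →
    cong (λ z → (if toℕ i ≡ᵇ toℕ j then Xₚ else []) +ₚ negₚ (constₚ z)) (β-entries k i j))

  -- Evaluating polynomials at a matrix

  -- The abstract setting shared by α_N, β_N (index set Fin N) and γ
  -- (index set ℕ): act f is the product A·f with the fixed matrix A, so
  -- it is linear, and ev p is the Horner evaluation p(A) of Defs.
  module PolyAction
    (Ix : Set) (I : Ix → Ix → ℤ) (act : (Ix → Ix → ℤ) → Ix → Ix → ℤ)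
    (act-cong : ∀ f g → (∀ i j → f i j ≡ g i j) → ∀ i j → act f i j ≡ act g i j)
    (act-lin : ∀ a b f g i j → act (λ x y → a * f x y + b * g x y) i j ≡ a * act f i j + b * act g i j)
    (ev : Poly → Ix → Ix → ℤ)
    (ev-nil : ∀ i j → ev [] i j ≡ + 0)
    (ev-cons : ∀ c cs i j → ev (c ∷ cs) i j ≡ c * I i j + act (ev cs) i j) where

    open ≡-Reasoning

    act-lin′ : ∀ a b f h g → (∀ x y → g x y ≡ a * f x y + b * h x y) →
               ∀ i j → act g i j ≡ a * act f i j + b * act h i j
    act-lin′ a b f h g e i j = trans (act-cong g _ e i j) (act-lin a b f h i j)

    act-0 : ∀ g → (∀ i j → g i j ≡ + 0) → ∀ i j → act g i j ≡ + 0
    act-0 g z i j = trans (act-lin′ (+ 0) (+ 0) g g g (λ x y → trans (z x y) (sym (zeros (g x y)))) i j)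
                          (zeros (act g i j))
      where
      zeros : ∀ u → + 0 * u + + 0 * u ≡ + 0
      zeros u = cong₂ _+_ (ℤP.*-zeroˡ u) (ℤP.*-zeroˡ u)

    act-+ : ∀ f h i j → act (λ x y → f x y + h x y) i j ≡ act f i j + act h i j
    act-+ f h i j = trans (act-lin′ (+ 1) (+ 1) f h _ (λ x y → sym (ones (f x y) (h x y))) i j)
                          (ones (act f i j) (act h i j))
      where
      ones : ∀ u v → + 1 * u + + 1 * v ≡ u + v
      ones = solve-∀

    act-* : ∀ c f i j → act (λ x y → c * f x y) i j ≡ c * act f i j
    act-* c f i j = trans (act-lin′ c (+ 0) f f _ (λ x y → sym (scale (f x y))) i j) (scale (act f i j))
      where
      scale : ∀ u → c * u + + 0 * u ≡ c * u
      scale u = trans (cong (λ z → c * u + z) (ℤP.*-zeroˡ u)) (ℤP.+-identityʳ (c * u))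

    act-- : ∀ f h i j → act (λ x y → f x y - h x y) i j ≡ act f i j - act h i j
    act-- f h i j = trans (act-lin′ (+ 1) -[1+ 0 ] f h _ (λ x y → sym (minus (f x y) (h x y))) i j)
                          (minus (act f i j) (act h i j))
      where
      minus : ∀ u v → + 1 * u + -[1+ 0 ] * v ≡ u - v
      minus = solve-∀

    ev-+ : ∀ p q i j → ev (p +ₚ q) i j ≡ ev p i j + ev q i j
    ev-+ []      q       i j = sym (trans (cong (_+ ev q i j) (ev-nil i j)) (ℤP.+-identityˡ (ev q i j)))
    ev-+ (a ∷ p) []      i j = sym (trans (cong (λ z → ev (a ∷ p) i j + z) (ev-nil i j)) (ℤP.+-identityʳ _))
    ev-+ (a ∷ p) (c ∷ q) i j = begin
        ev ((a + c) ∷ (p +ₚ q)) i j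
      ≡⟨ ev-cons (a + c) (p +ₚ q) i j ⟩
        (a + c) * I i j + act (ev (p +ₚ q)) i j
      ≡⟨ cong (λ z → (a + c) * I i j + z) (trans (act-cong _ _ (ev-+ p q) i j) (act-+ (ev p) (ev q) i j)) ⟩
        (a + c) * I i j + (act (ev p) i j + act (ev q) i j)
      ≡⟨ regroup a c (I i j) (act (ev p) i j) (act (ev q) i j) ⟩
        (a * I i j + act (ev p) i j) + (c * I i j + act (ev q) i j)
      ≡⟨ sym (cong₂ _+_ (ev-cons a p i j) (ev-cons c q i j)) ⟩
        ev (a ∷ p) i j + ev (c ∷ q) i j ∎
      where
      regroup : ∀ a c u v w → (a + c) * u + (v + w) ≡ (a * u + v) + (c * u + w)
      regroup = solve-∀

    ev-scal : ∀ c p i j → ev (scalₚ c p) i j ≡ c * ev p i j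
    ev-scal c []      i j = trans (ev-nil i j) (sym (trans (cong (c *_) (ev-nil i j)) (ℤP.*-zeroʳ c)))
    ev-scal c (a ∷ p) i j = begin
        ev ((c * a) ∷ scalₚ c p) i j
      ≡⟨ ev-cons (c * a) (scalₚ c p) i j ⟩
        c * a * I i j + act (ev (scalₚ c p)) i j
      ≡⟨ cong (λ z → c * a * I i j + z) (trans (act-cong _ _ (ev-scal c p) i j) (act-* c (ev p) i j)) ⟩
        c * a * I i j + c * act (ev p) i j
      ≡⟨ factor c a (I i j) (act (ev p) i j) ⟩
        c * (a * I i j + act (ev p) i j)
      ≡⟨ cong (c *_) (sym (ev-cons a p i j)) ⟩
        c * ev (a ∷ p) i j ∎
      where
      factor : ∀ c a u v → c * a * u + c * v ≡ c * (a * u + v)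
      factor = solve-∀

    ev-neg : ∀ p i j → ev (negₚ p) i j ≡ - ev p i j
    ev-neg p i j = trans (cong (λ q → ev q i j) (negₚ≡scal p))
                         (trans (ev-scal -[1+ 0 ] p i j) (ℤP.-1*i≡-i (ev p i j)))
      where
      negₚ≡scal : ∀ p → negₚ p ≡ scalₚ -[1+ 0 ] p
      negₚ≡scal []      = refl
      negₚ≡scal (a ∷ p) = cong₂ _∷_ (sym (ℤP.-1*i≡-i a)) (negₚ≡scal p)

    ev-*cons : ∀ a p q i j → ev ((a ∷ p) *ₚ q) i j ≡ a * ev q i j + act (ev (p *ₚ q)) i j
    ev-*cons a p q i j = trans (ev-+ (scalₚ a q) (+ 0 ∷ (p *ₚ q)) i j)
      (cong₂ _+_ (ev-scal a q i j)
                 (trans (ev-cons (+ 0) (p *ₚ q) i j)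
                        (trans (cong (_+ act (ev (p *ₚ q)) i j) (ℤP.*-zeroˡ (I i j))) (ℤP.+-identityˡ _))))

    ev-*-zeroʳ : ∀ p q → (∀ i j → ev q i j ≡ + 0) → ∀ i j → ev (p *ₚ q) i j ≡ + 0
    ev-*-zeroʳ []      q z i j = ev-nil i j
    ev-*-zeroʳ (a ∷ p) q z i j = trans (ev-*cons a p q i j)
      (cong₂ _+_ (trans (cong (a *_) (z i j)) (ℤP.*-zeroʳ a)) (act-0 _ (ev-*-zeroʳ p q z) i j))

    ev-*-zeroˡ : ∀ p q → AllZero p → ∀ i j → ev (p *ₚ q) i j ≡ + 0
    ev-*-zeroˡ []      q _         i j = ev-nil i j
    ev-*-zeroˡ (a ∷ p) q (a≡0 , pz) i j = trans (ev-*cons a p q i j)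
      (cong₂ _+_ (trans (cong (_* ev q i j) a≡0) (ℤP.*-zeroˡ (ev q i j))) (act-0 _ (ev-*-zeroˡ p q pz) i j))

    ev-*const : ∀ a q i j → ev ((a ∷ []) *ₚ q) i j ≡ a * ev q i j
    ev-*const a q i j = trans (ev-*cons a [] q i j)
      (trans (cong (λ z → a * ev q i j + z) (act-0 _ ev-nil i j)) (ℤP.+-identityʳ _))

    ev-*linear : ∀ a c q i j → ev ((a ∷ c ∷ []) *ₚ q) i j ≡ a * ev q i j + c * act (ev q) i j
    ev-*linear a c q i j = trans (ev-*cons a (c ∷ []) q i j)
      (cong (λ z → a * ev q i j + z) (trans (act-cong _ _ (ev-*const c q) i j) (act-* c (ev q) i j)))

    ev-one : ∀ i j → ev (constₚ (+ 1)) i j ≡ I i j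
    ev-one i j = trans (ev-cons (+ 1) [] i j)
      (trans (cong₂ _+_ (ℤP.*-identityˡ (I i j)) (act-0 _ ev-nil i j)) (ℤP.+-identityʳ _))

    ev-sgn : ∀ m x i j → ev (OP.sgn m x) i j ≡ sgn m (ev x i j)
    ev-sgn zero    x i j = refl
    ev-sgn (suc m) x i j = trans (ev-neg (OP.sgn m x) i j) (cong -_ (ev-sgn m x i j))

    ev-sum : ∀ n (f : Fin n → Poly) i j → ev (OP.sumFin n f) i j ≡ sumFin n (λ l → ev (f l) i j)
    ev-sum zero    f i j = ev-nil i j
    ev-sum (suc n) f i j = trans (ev-+ (f fz) _ i j)
      (cong (λ z → ev (f fz) i j + z) (ev-sum n (λ l → f (fs l)) i j))

    ev-signedSum-0 : ∀ n (e : Fin n → ℕ) (t : Fin n → Poly) i j → (∀ l → ev (t l) i j ≡ + 0) →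
                     ev (OP.sumFin n (λ l → OP.sgn (e l) (t l))) i j ≡ + 0
    ev-signedSum-0 n e t i j z = trans (ev-sum n _ i j)
      (sumFin-0 n _ (λ l → trans (ev-sgn (e l) (t l) i j) (trans (cong (sgn (e l)) (z l)) (sgn-0 (e l)))))

    -- A determinant with a zero column evaluates to 0 (by induction: in
    -- the row-0 expansion each minor except one keeps the zero column).
    ev-det-zeroCol : ∀ n (A : Fin (suc n) → Fin (suc n) → Poly) c → (∀ r → AllZero (A r c)) →
                     ∀ i j → ev (detₚ (suc n) A) i j ≡ + 0
    minor-zeroCol : ∀ n (A : Fin (suc n) → Fin (suc n) → Poly) c → (∀ r → AllZero (A r c)) →
                    ∀ l → l ≢ c → ∀ i j → ev (detₚ n (λ r c′ → A (fs r) (punchIn l c′))) i j ≡ + 0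

    ev-det-zeroCol n A c hz i j = ev-signedSum-0 (suc n) toℕ _ i j vanish
      where
      minor : Fin (suc n) → Poly
      minor l = detₚ n (λ r c′ → A (fs r) (punchIn l c′))
      vanish : ∀ l → ev (A fz l *ₚ minor l) i j ≡ + 0
      vanish l with l Fin.≟ c
      ... | yes refl = ev-*-zeroˡ (A fz l) (minor l) (hz fz) i j
      ... | no  l≢c  = ev-*-zeroʳ (A fz l) (minor l) (minor-zeroCol n A c hz l l≢c) i j

    minor-zeroCol zero    A fz hz fz l≢c i j = ⊥-elim (l≢c refl)
    minor-zeroCol (suc n) A c  hz l  l≢c i j =
      ev-det-zeroCol n (λ r c′ → A (fs r) (punchIn l c′)) (punchOut l≢c)
        (λ r → subst AllZero (cong (A (fs r)) (sym (FinP.punchIn-punchOut l≢c))) (hz (fs r))) i j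

    ev-charDet-1 : ∀ S i j → ev (charDet 1 S) i j ≡ act I i j - S 0 0 * I i j
    ev-charDet-1 S i j = begin
        ev (((a ∷ + 1 ∷ []) *ₚ constₚ (+ 1)) +ₚ []) i j
      ≡⟨ ev-+ ((a ∷ + 1 ∷ []) *ₚ constₚ (+ 1)) [] i j ⟩
        ev ((a ∷ + 1 ∷ []) *ₚ constₚ (+ 1)) i j + ev [] i j
      ≡⟨ cong₂ _+_ (ev-*linear a (+ 1) (constₚ (+ 1)) i j) (ev-nil i j) ⟩
        a * ev (constₚ (+ 1)) i j + + 1 * act (ev (constₚ (+ 1))) i j + + 0
      ≡⟨ cong₂ (λ u v → a * u + + 1 * v + + 0) (ev-one i j) (act-cong _ _ ev-one i j) ⟩
        a * I i j + + 1 * act I i j + + 0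
      ≡⟨ simplify (S 0 0) (I i j) (act I i j) ⟩
        act I i j - S 0 0 * I i j ∎
      where
      a = + 0 + - S 0 0
      simplify : ∀ s u v → (+ 0 + - s) * u + + 1 * v + + 0 ≡ v - s * u
      simplify = solve-∀

    ev-minor01-tail : ∀ n S → (∀ i → S (suc (suc i)) 0 ≡ + 0) → ∀ i j →
      let B = λ (r c : Fin (suc n)) → charEntry S (toℕ (fs r)) (toℕ (punchIn (fs fz) c)) in
      ev (OP.sumFin n (λ l → OP.sgn (suc (toℕ l)) (B fz (fs l) *ₚ detₚ n (λ r c → B (fs r) (punchIn (fs l) c))))) i j
        ≡ + 0
    ev-minor01-tail zero    S si0 i j = ev-nil i j
    ev-minor01-tail (suc n) S si0 i j = ev-signedSum-0 (suc n) (λ l → suc (toℕ l)) _ i j (λ l →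
      ev-*-zeroʳ (B fz (fs l)) _ (ev-det-zeroCol n (λ r c → B (fs r) (punchIn (fs l) c)) fz
        (λ r → cong -_ (si0 (toℕ r)) , tt)) i j)
      where
      B : Fin (suc (suc n)) → Fin (suc (suc n)) → Poly
      B r c = charEntry S (toℕ (fs r)) (toℕ (punchIn (fs fz) c))

    ev-charDet-rec : ∀ n S → S 0 1 ≡ + 1 → S 1 0 ≡ + 1 →
      (∀ j → S 0 (suc (suc j)) ≡ + 0) → (∀ i → S (suc (suc i)) 0 ≡ + 0) → ∀ i j →
      ev (charDet (suc (suc n)) S) i j
        ≡ act (ev (charDet (suc n) (shift S))) i j - S 0 0 * ev (charDet (suc n) (shift S)) i j
          - ev (charDet n (shift (shift S))) i j
    ev-charDet-rec n S s01 s10 s0j si0 i j = begin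
        ev (t0 +ₚ (t1 +ₚ rest)) i j
      ≡⟨ ev-+ t0 (t1 +ₚ rest) i j ⟩
        ev t0 i j + ev (t1 +ₚ rest) i j
      ≡⟨ cong (λ z → ev t0 i j + z) (ev-+ t1 rest i j) ⟩
        ev t0 i j + (ev t1 i j + ev rest i j)
      ≡⟨ cong₂ _+_ ev-t0 (cong₂ _+_ ev-t1 ev-rest) ⟩
        ((+ 0 + - S 0 0) * D1 + + 1 * act (ev (charDet (suc n) (shift S))) i j)
          + (- (- S 0 1 * (- S 1 0 * D0 + + 0)) + + 0)
      ≡⟨ cong₂ (λ u v → ((+ 0 + - S 0 0) * D1 + + 1 * act (ev (charDet (suc n) (shift S))) i j)
                          + (- (- u * (- v * D0 + + 0)) + + 0)) s01 s10 ⟩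
        ((+ 0 + - S 0 0) * D1 + + 1 * act (ev (charDet (suc n) (shift S))) i j)
          + (- (- + 1 * (- + 1 * D0 + + 0)) + + 0)
      ≡⟨ simplify (S 0 0) D1 (act (ev (charDet (suc n) (shift S))) i j) D0 ⟩
        act (ev (charDet (suc n) (shift S))) i j - S 0 0 * D1 - D0 ∎
      where
      A : Fin (suc (suc n)) → Fin (suc (suc n)) → Poly
      A r c = charEntry S (toℕ r) (toℕ c)
      D1 = ev (charDet (suc n) (shift S)) i j
      D0 = ev (charDet n (shift (shift S))) i j
      t0 = A fz fz *ₚ detₚ (suc n) (λ r c → A (fs r) (punchIn fz c))
      B : Fin (suc n) → Fin (suc n) → Poly
      B r c = A (fs r) (punchIn (fs fz) c)
      t1 = OP.sgn 1 (A fz (fs fz) *ₚ detₚ (suc n) B)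
      rest = OP.sumFin n (λ l → OP.sgn (toℕ (fs (fs l)))
               (A fz (fs (fs l)) *ₚ detₚ (suc n) (λ r c → A (fs r) (punchIn (fs (fs l)) c))))
      simplify : ∀ s p mp q → ((+ 0 + - s) * p + + 1 * mp) + (- (- + 1 * (- + 1 * q + + 0)) + + 0)
                              ≡ mp - s * p - q
      simplify = solve-∀
      ev-t0 : ev t0 i j ≡ (+ 0 + - S 0 0) * D1 + + 1 * act (ev (charDet (suc n) (shift S))) i j
      ev-t0 = ev-*linear (+ 0 + - S 0 0) (+ 1) _ i j
      ev-detB : ev (detₚ (suc n) B) i j ≡ - S 1 0 * D0 + + 0
      ev-detB = trans (ev-+ _ _ i j) (cong₂ _+_ (ev-*const (- S 1 0) _ i j) (ev-minor01-tail n S si0 i j))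
      ev-t1 : ev t1 i j ≡ - (- S 0 1 * (- S 1 0 * D0 + + 0))
      ev-t1 = trans (ev-neg _ i j) (cong -_ (trans (ev-*const (- S 0 1) _ i j) (cong (- S 0 1 *_) ev-detB)))
      ev-rest : ev rest i j ≡ + 0
      ev-rest = ev-signedSum-0 n (λ l → suc (suc (toℕ l))) _ i j
                  (λ l → ev-*-zeroˡ _ _ (cong -_ (s0j (toℕ l)) , tt) i j)

    -- Φ m = det(x I - βcore m) evaluated at A.  Removing the first row
    -- and column of βcore (m+1) gives βcore m, so Φ obeys the Chebyshev
    -- recurrence.
    Φ : ℕ → Ix → Ix → ℤ
    Φ m = ev (charDet m (βcore m))

    Φ-1 : ∀ i j → Φ 1 i j ≡ act I i j + I i j
    Φ-1 i j = trans (ev-charDet-1 (βcore 1) i j) (simplify (act I i j) (I i j))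
      where
      simplify : ∀ u v → u - -[1+ 0 ] * v ≡ u + v
      simplify = solve-∀

    βcore-10 : ∀ n → βcore (suc (suc n)) 1 0 ≡ + 1
    βcore-10 n = cong (λ z → + 0 + + 1 - z) (ℤP.*-zeroʳ (δ 2 (suc (suc n))))
    βcore-0j : ∀ n j → βcore (suc (suc n)) 0 (suc (suc j)) ≡ + 0
    βcore-0j n j = refl
    βcore-i0 : ∀ n i → βcore (suc (suc n)) (suc (suc i)) 0 ≡ + 0
    βcore-i0 n i = cong (λ z → + 0 + + 0 - z) (ℤP.*-zeroʳ (δ (suc (suc (suc i))) (suc (suc n))))

    Φ-rec : ∀ n i j → Φ (suc (suc n)) i j ≡ act (Φ (suc n)) i j - Φ n i j
    Φ-rec n i j =
      trans (ev-charDet-rec n (βcore (suc (suc n))) refl (βcore-10 n) (βcore-0j n) (βcore-i0 n) i j)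
            (simplify (act (Φ (suc n)) i j) (Φ (suc n) i j) (Φ n i j))
      where
      simplify : ∀ u v w → u - + 0 * v - w ≡ u - w
      simplify = solve-∀

    ev-b1 : ∀ i j → ev (b 1) i j ≡ act I i j
    ev-b1 i j = trans (cong (λ p → ev p i j) (b≡charDet 1))
                      (trans (ev-charDet-1 (βδ 1) i j) (simplify (act I i j) (I i j)))
      where
      simplify : ∀ u v → u - + 0 * v ≡ u
      simplify = solve-∀

    -- Expanding b_{n+2} = det(x I - β_{n+2}) once expresses it through Φ.
    Ψ : ℕ → Ix → Ix → ℤ
    Ψ n i j = act (Φ (suc n)) i j - Φ (suc n) i j - Φ n i j

    ev-b2+ : ∀ n i j → ev (b (suc (suc n))) i j ≡ Ψ n i j
    ev-b2+ n i j = begin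
        ev (b (suc (suc n))) i j
      ≡⟨ cong (λ p → ev p i j) (b≡charDet (suc (suc n))) ⟩
        ev (charDet (suc (suc n)) S) i j
      ≡⟨ ev-charDet-rec n S refl (cong (_+ + 0) (βcore-10 n)) (λ _ → refl)
                            (λ i → cong (_+ + 0) (βcore-i0 n i)) i j ⟩
        act (ev D1) i j - S 0 0 * ev D1 i j - ev D0 i j
      ≡⟨ cong₂ (λ u v → act (ev u) i j - S 0 0 * ev u i j - ev v i j)
               (charDet-cong (suc n) (λ a c → ℤP.+-identityʳ (βcore (suc n) a c)))
               (charDet-cong n (λ a c → ℤP.+-identityʳ (βcore n a c))) ⟩
        act (Φ (suc n)) i j - + 1 * Φ (suc n) i j - Φ n i j
      ≡⟨ cong (λ z → act (Φ (suc n)) i j - z - Φ n i j) (ℤP.*-identityˡ _) ⟩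
        Ψ n i j ∎
      where
      S = βδ (suc (suc n))
      D1 = charDet (suc n) (shift S)
      D0 = charDet n (shift (shift S))

    lucas : ℕ → Ix → Ix → ℤ
    lucas zero          i j = + 2 * I i j
    lucas (suc zero)    i j = act I i j
    lucas (suc (suc k)) i j = act (lucas (suc k)) i j - lucas k i j

    Ψ-rec : ∀ n i j → Ψ (suc (suc n)) i j ≡ act (Ψ (suc n)) i j - Ψ n i j
    Ψ-rec n i j = begin
        act (Φ (3+ n)) i j - Φ (3+ n) i j - Φ (2+ n) i j
      ≡⟨ cong₂ (λ u v → u - v - Φ (2+ n) i j)
               (trans (act-cong _ _ (Φ-rec (suc n)) i j) (act-- _ _ i j)) (Φ-rec (suc n) i j) ⟩
        (a - c) - (a′ - p) - Φ (2+ n) i j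
      ≡⟨ cong (λ z → (a - c) - (a′ - p) - z) (Φ-rec n i j) ⟩
        (a - c) - (a′ - p) - (c - q)
      ≡⟨ regroup a a′ c p q ⟩
        (a - a′ - c) - (c - p - q)
      ≡⟨ cong (_- Ψ n i j) (sym (trans (act-- _ _ i j) (cong (_- c) (act-- _ _ i j)))) ⟩
        act (Ψ (suc n)) i j - Ψ n i j ∎
      where
      3+_ 2+_ : ℕ → ℕ
      3+ n = suc (suc (suc n))
      2+ n = suc (suc n)
      a  = act (act (Φ (2+ n))) i j
      a′ = act (Φ (2+ n)) i j
      c  = act (Φ (suc n)) i j
      p  = Φ (suc n) i j
      q  = Φ n i j
      regroup : ∀ a a′ c p q → (a - c) - (a′ - p) - (c - q) ≡ (a - a′ - c) - (c - p - q)
      regroup = solve-∀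

    Φ-0 : ∀ i j → Φ 0 i j ≡ I i j
    Φ-0 = ev-one

    lucas-2 : ∀ i j → lucas 2 i j ≡ Ψ 0 i j
    lucas-2 i j = begin
        act (act I) i j - + 2 * I i j
      ≡⟨ expand (act (act I) i j) (act I i j) (I i j) ⟩
        (act (act I) i j + act I i j) - (act I i j + I i j) - I i j
      ≡⟨ sym (cong₃ (trans (act-cong _ _ Φ-1 i j) (act-+ (act I) I i j)) (Φ-1 i j) (Φ-0 i j)) ⟩
        Ψ 0 i j ∎
      where
      expand : ∀ a m u → a - + 2 * u ≡ (a + m) - (m + u) - u
      expand = solve-∀
      cong₃ : ∀ {a a′ b b′ c c′ : ℤ} → a ≡ a′ → b ≡ b′ → c ≡ c′ → a - b - c ≡ a′ - b′ - c′
      cong₃ refl refl refl = refl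

    lucas-3 : ∀ i j → lucas 3 i j ≡ Ψ 1 i j
    lucas-3 i j = begin
        act (lucas 2) i j - act I i j
      ≡⟨ cong₂ _-_ (act-cong _ _ lucas-2 i j) (sym (act-cong _ _ Φ-0 i j)) ⟩
        act (Ψ 0) i j - c
      ≡⟨ cong (_- c) (trans (act-- _ _ i j) (cong (_- c) (act-- _ _ i j))) ⟩
        (a - a′ - c) - c
      ≡⟨ regroup a a′ c (Φ 0 i j) ⟩
        (a - c) - (a′ - Φ 0 i j) - (c + Φ 0 i j)
      ≡⟨ cong (λ z → (a - c) - (a′ - Φ 0 i j) - z)
              (sym (trans (Φ-1 i j) (cong₂ _+_ (sym (act-cong _ _ Φ-0 i j)) (sym (Φ-0 i j))))) ⟩
        (a - c) - (a′ - Φ 0 i j) - Φ 1 i j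
      ≡⟨ cong₂ (λ u v → u - v - Φ 1 i j) (sym (trans (act-cong _ _ (Φ-rec 0) i j) (act-- _ _ i j)))
               (sym (Φ-rec 0 i j)) ⟩
        Ψ 1 i j ∎
      where
      a  = act (act (Φ 1)) i j
      a′ = act (Φ 1) i j
      c  = act (Φ 0) i j
      regroup : ∀ a a′ c q → (a - a′ - c) - c ≡ (a - c) - (a′ - q) - (c + q)
      regroup = solve-∀

    lucas≡Ψ : ∀ n → (∀ i j → lucas (suc (suc n)) i j ≡ Ψ n i j)
                  × (∀ i j → lucas (suc (suc (suc n))) i j ≡ Ψ (suc n) i j)
    lucas≡Ψ zero    = lucas-2 , lucas-3
    lucas≡Ψ (suc n) with lucas≡Ψ n
    ... | h₂ , h₃ = h₃ , λ i j → trans (cong₂ _-_ (act-cong _ _ h₃ i j) (h₂ i j)) (sym (Ψ-rec n i j))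

    ev-b≡lucas : ∀ k → 1 ≤ k → ∀ i j → ev (b k) i j ≡ lucas k i j
    ev-b≡lucas (suc zero)    _ = ev-b1
    ev-b≡lucas (suc (suc n)) _ i j = trans (ev-b2+ n i j) (sym (proj₁ (lucas≡Ψ n) i j))

  -- The matrix γ^(k) and the determinants of its leading blocks

  -- Γ k is γ^(k) with its defining conditions written as deltas:
  -- j = i + k, i = j + k, or i + j + 1 = k (these are mutually exclusive).
  Γ : ℕ → ℕ → ℕ → ℤ
  Γ k i j = δ j (i ℕ.+ k) + δ i (j ℕ.+ k) + δ (suc (i ℕ.+ j)) k

  Γ-0 : ∀ {k i j} → j ≢ i ℕ.+ k → i ≢ j ℕ.+ k → suc (i ℕ.+ j) ≢ k → Γ k i j ≡ + 0
  Γ-0 a b c rewrite δ-≢ a | δ-≢ b | δ-≢ c = refl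

  Γ-above : ∀ {k i j} → j ≡ i ℕ.+ k → i ≢ j ℕ.+ k → suc (i ℕ.+ j) ≢ k → Γ k i j ≡ + 1
  Γ-above a b c rewrite δ-≡ a | δ-≢ b | δ-≢ c = refl

  Γ-below : ∀ {k i j} → j ≢ i ℕ.+ k → i ≡ j ℕ.+ k → suc (i ℕ.+ j) ≢ k → Γ k i j ≡ + 1
  Γ-below a b c rewrite δ-≢ a | δ-≡ b | δ-≢ c = refl

  >⇒≢ : ∀ {a b} → b < a → a ≢ b
  >⇒≢ b<a e = ℕP.<⇒≢ b<a (sym e)

  -- gap c t j: the column index j, shifted by t from position c on; the
  -- matrix Γ k i (gap c t j) is Γ k with t columns deleted at c.
  gap : ℕ → ℕ → ℕ → ℕ
  gap c t j = if j <ᵇ c then j else t ℕ.+ j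

  gap-< : ∀ {c t j} → j < c → gap c t j ≡ j
  gap-< {c} {t} {j} j<c with j <ᵇ c in eq
  ... | true  = refl
  ... | false = ⊥-elim (subst T eq (ℕP.<⇒<ᵇ j<c))

  gap-≥ : ∀ {c t j} → c ≤ j → gap c t j ≡ t ℕ.+ j
  gap-≥ {c} {t} {j} c≤j with j <ᵇ c in eq
  ... | true  = ⊥-elim (ℕP.<⇒≱ (ℕP.<ᵇ⇒< j c (subst T (sym eq) _)) c≤j)
  ... | false = refl

  gap-≤ : ∀ c t j → gap c t j ≤ t ℕ.+ j
  gap-≤ c t j with j <ᵇ c
  ... | true  = ℕP.m≤n+m j t
  ... | false = ℕP.≤-refl

  gap-0 : ∀ c j → gap c 0 j ≡ j
  gap-0 c j with j <ᵇ c
  ... | true  = refl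
  ... | false = refl

  gap-skip : ∀ c t j → gap (suc c) t (skip c j) ≡ gap c (suc t) j
  gap-skip c t j with skip-case c j
  ... | inj₁ (j<c , e) = trans (cong (gap (suc c) t) e)
                               (trans (gap-< (ℕP.m<n⇒m<1+n j<c)) (sym (gap-< j<c)))
  ... | inj₂ (c≤j , e) = trans (cong (gap (suc c) t) e)
                               (trans (gap-≥ (s≤s c≤j)) (trans (ℕP.+-suc t j) (sym (gap-≥ c≤j))))

  square-parity : ∀ k → Σ ℕ (λ w → k ℕ.* k ≡ k ℕ.+ (w ℕ.+ w))
  square-parity zero    = 0 , refl
  square-parity (suc k) with square-parity k
  ... | w , e = w ℕ.+ k , trans (expand k) (trans (cong (λ z → suc (k ℕ.+ k ℕ.+ z)) e) (regroup k w))
    where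
    expand : ∀ k → suc k ℕ.* suc k ≡ suc (k ℕ.+ k ℕ.+ k ℕ.* k)
    expand = ℕSolver.solve-∀
    regroup : ∀ k w → suc (k ℕ.+ k ℕ.+ (k ℕ.+ (w ℕ.+ w))) ≡ suc k ℕ.+ ((w ℕ.+ k) ℕ.+ (w ℕ.+ k))
    regroup = ℕSolver.solve-∀

  module DetΓ (k′ : ℕ) where
    k : ℕ
    k = suc k′

    gapped-lastRow : ∀ M s t → suc s ℕ.+ t ≤ k →
      let r = s ℕ.+ (M ℕ.+ k) ; F = λ i j → Γ k i (gap (M ℕ.+ suc s) t j) in
      (∀ j → j ≤ r → j ≢ M ℕ.+ s → F r j ≡ + 0) × (F r (M ℕ.+ s) ≡ + 1)
    gapped-lastRow M s t le = zero-elsewhere , one-at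
      where
      r = s ℕ.+ (M ℕ.+ k)
      r≡ : r ≡ (M ℕ.+ s) ℕ.+ k
      r≡ = rearrange s M k
        where
        rearrange : ∀ s M k → s ℕ.+ (M ℕ.+ k) ≡ (M ℕ.+ s) ℕ.+ k
        rearrange = ℕSolver.solve-∀
      t<k : t < k
      t<k = ℕP.<-≤-trans (s≤s (ℕP.m≤n+m t s)) le
      no-antidiag : ∀ x → suc (r ℕ.+ x) ≢ k
      no-antidiag x = >⇒≢ (s≤s (ℕP.≤-trans (ℕP.≤-trans (ℕP.m≤n+m k M) (ℕP.m≤n+m (M ℕ.+ k) s)) (ℕP.m≤m+n r x)))
      zero-elsewhere : ∀ j → j ≤ r → j ≢ M ℕ.+ s → Γ k r (gap (M ℕ.+ suc s) t j) ≡ + 0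
      zero-elsewhere j j≤r j≢ = Γ-0 not-above not-below (no-antidiag x)
        where
        x = gap (M ℕ.+ suc s) t j
        not-above : x ≢ r ℕ.+ k
        not-above = ℕP.<⇒≢ (subst (x <_) (ℕP.+-comm k r)
                      (ℕP.≤-<-trans (gap-≤ (M ℕ.+ suc s) t j) (ℕP.+-mono-<-≤ t<k j≤r)))
        x≢ : x ≢ M ℕ.+ s
        x≢ with j ℕ.<? M ℕ.+ suc s
        ... | yes j< = λ e → j≢ (trans (sym (gap-< j<)) e)
        ... | no  j≮ = λ e → ℕP.<-irrefl (sym e)
                (ℕP.<-≤-trans (ℕP.+-monoʳ-< M (ℕP.n<1+n s))
                   (subst (M ℕ.+ suc s ≤_) (sym (gap-≥ (ℕP.≮⇒≥ j≮))) (ℕP.≤-trans (ℕP.≮⇒≥ j≮) (ℕP.m≤n+m j t))))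
        not-below : r ≢ x ℕ.+ k
        not-below e = x≢ (sym (ℕP.+-cancelʳ-≡ k (M ℕ.+ s) x (trans (sym r≡) e)))
      one-at : Γ k r (gap (M ℕ.+ suc s) t (M ℕ.+ s)) ≡ + 1
      one-at = trans (cong (Γ k r) (gap-< {t = t} (ℕP.+-monoʳ-< M (ℕP.n<1+n s))))
        (Γ-below (ℕP.<⇒≢ (ℕP.≤-<-trans (subst (M ℕ.+ s ≤_) (sym r≡) (ℕP.m≤m+n (M ℕ.+ s) k))
                                        (ℕP.m<m+n r (s≤s z≤n))))
                 r≡ (no-antidiag (M ℕ.+ s)))

    det-peelRows : ∀ M s t → s ℕ.+ t ≤ k →
      detN (s ℕ.+ (M ℕ.+ k)) (λ i j → Γ k i (gap (M ℕ.+ s) t j))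
        ≡ sgn (k ℕ.* s) (detN (M ℕ.+ k) (λ i j → Γ k i (gap M (s ℕ.+ t) j)))
    det-peelRows M zero    t _  = trans (detN-cong (M ℕ.+ k) (λ i j _ _ → cong (λ c → Γ k i (gap c t j)) (ℕP.+-identityʳ M)))
                                        (sgn-cong _ (sym (ℕP.*-zeroʳ k)))
    det-peelRows M (suc s) t le = begin
        detN (suc r) F
      ≡⟨ detN-lastRow r F (M ℕ.+ s) (subst (M ℕ.+ s ≤_) (sym r≡) (ℕP.m≤m+n (M ℕ.+ s) k)) zero-elsewhere ⟩
        sgn (r ℕ.+ (M ℕ.+ s)) (F r (M ℕ.+ s) * detN r (λ i j → F i (skip (M ℕ.+ s) j)))
      ≡⟨ cong₂ (λ u v → sgn (r ℕ.+ (M ℕ.+ s)) (u * v)) one-at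
          (detN-cong r (λ i j _ _ → cong (Γ k i)
            (trans (cong (λ c → gap c t (skip (M ℕ.+ s) j)) (ℕP.+-suc M s)) (gap-skip (M ℕ.+ s) t j)))) ⟩
        sgn (r ℕ.+ (M ℕ.+ s)) (+ 1 * detN r (λ i j → Γ k i (gap (M ℕ.+ s) (suc t) j)))
      ≡⟨ cong (sgn (r ℕ.+ (M ℕ.+ s))) (ℤP.*-identityˡ _) ⟩
        sgn (r ℕ.+ (M ℕ.+ s)) (detN r (λ i j → Γ k i (gap (M ℕ.+ s) (suc t) j)))
      ≡⟨ cong (sgn (r ℕ.+ (M ℕ.+ s))) (det-peelRows M s (suc t) (subst (_≤ k) (sym (ℕP.+-suc s t)) le)) ⟩
        sgn (r ℕ.+ (M ℕ.+ s)) (sgn (k ℕ.* s) D)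
      ≡⟨ sym (sgn-+ (r ℕ.+ (M ℕ.+ s)) (k ℕ.* s) D) ⟩
        sgn (r ℕ.+ (M ℕ.+ s) ℕ.+ k ℕ.* s) D
      ≡⟨ sgn-cong D (exponent s M k) ⟩
        sgn (k ℕ.* suc s ℕ.+ ((M ℕ.+ s) ℕ.+ (M ℕ.+ s))) D
      ≡⟨ sgn-even (k ℕ.* suc s) (M ℕ.+ s) D ⟩
        sgn (k ℕ.* suc s) D
      ≡⟨ cong (sgn (k ℕ.* suc s)) (detN-cong (M ℕ.+ k) (λ i j _ _ → cong (λ z → Γ k i (gap M z j)) (ℕP.+-suc s t))) ⟩
        sgn (k ℕ.* suc s) (detN (M ℕ.+ k) (λ i j → Γ k i (gap M (suc s ℕ.+ t) j))) ∎
      where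
      open ≡-Reasoning
      r = s ℕ.+ (M ℕ.+ k)
      F : ℕ → ℕ → ℤ
      F i j = Γ k i (gap (M ℕ.+ suc s) t j)
      D = detN (M ℕ.+ k) (λ i j → Γ k i (gap M (s ℕ.+ suc t) j))
      r≡ : r ≡ (M ℕ.+ s) ℕ.+ k
      r≡ = rearrange s M k
        where
        rearrange : ∀ s M k → s ℕ.+ (M ℕ.+ k) ≡ (M ℕ.+ s) ℕ.+ k
        rearrange = ℕSolver.solve-∀
      exponent : ∀ s M k → (s ℕ.+ (M ℕ.+ k)) ℕ.+ (M ℕ.+ s) ℕ.+ k ℕ.* s
                           ≡ k ℕ.* suc s ℕ.+ ((M ℕ.+ s) ℕ.+ (M ℕ.+ s))
      exponent = ℕSolver.solve-∀
      zero-elsewhere : ∀ j → j ≤ r → j ≢ M ℕ.+ s → F r j ≡ + 0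
      zero-elsewhere = proj₁ (gapped-lastRow M s t le)
      one-at : F r (M ℕ.+ s) ≡ + 1
      one-at = proj₂ (gapped-lastRow M s t le)

    -- With a gap of k columns at M, the columns from M on are
    -- upper-triangular with unit diagonal (super-diagonal j = i + k), so
    -- they contribute a factor 1.
    det-peelCols : ∀ M s → s ≤ k → detN (s ℕ.+ M) (λ i j → Γ k i (gap M k j)) ≡ detN M (Γ k)
    det-peelCols M zero    _  = detN-cong M (λ i j _ j<M → cong (Γ k i) (gap-< {t = k} j<M))
    det-peelCols M (suc s) le = begin
        detN (suc (s ℕ.+ M)) F
      ≡⟨ detN-lastCol (s ℕ.+ M) F above-zero ⟩
        F (s ℕ.+ M) (s ℕ.+ M) * detN (s ℕ.+ M) F
      ≡⟨ cong (_* detN (s ℕ.+ M) F) diagonal ⟩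
        + 1 * detN (s ℕ.+ M) F
      ≡⟨ ℤP.*-identityˡ _ ⟩
        detN (s ℕ.+ M) F
      ≡⟨ det-peelCols M s (ℕP.m≤n⇒m≤1+n (ℕP.≤-pred le)) ⟩
        detN M (Γ k) ∎
      where
      open ≡-Reasoning
      F : ℕ → ℕ → ℤ
      F i j = Γ k i (gap M k j)
      shifted : gap M k (s ℕ.+ M) ≡ k ℕ.+ (s ℕ.+ M)
      shifted = gap-≥ {M} {k} (ℕP.m≤n+m M s)
      above-zero : ∀ i → i < s ℕ.+ M → F i (s ℕ.+ M) ≡ + 0
      above-zero i i< = trans (cong (Γ k i) shifted) (Γ-0
         (>⇒≢ (subst (i ℕ.+ k <_) (ℕP.+-comm (s ℕ.+ M) k) (ℕP.+-monoˡ-< k i<)))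
         (ℕP.<⇒≢ (ℕP.<-≤-trans i< (ℕP.≤-trans (ℕP.m≤n+m (s ℕ.+ M) k) (ℕP.m≤m+n _ k))))
         (>⇒≢ (s≤s (ℕP.≤-trans (ℕP.m≤m+n k (s ℕ.+ M)) (ℕP.m≤n+m _ i)))))
      diagonal : F (s ℕ.+ M) (s ℕ.+ M) ≡ + 1
      diagonal = trans (cong (Γ k (s ℕ.+ M)) shifted) (Γ-above (ℕP.+-comm k (s ℕ.+ M))
         (ℕP.<⇒≢ (ℕP.<-≤-trans (ℕP.m<n+m (s ℕ.+ M) {k} (s≤s z≤n)) (ℕP.m≤m+n (k ℕ.+ (s ℕ.+ M)) k)))
         (>⇒≢ (s≤s (ℕP.≤-trans (ℕP.m≤m+n k (s ℕ.+ M)) (ℕP.m≤n+m _ (s ℕ.+ M))))))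

    det-period : ∀ X → detN (X ℕ.+ (k ℕ.+ k)) (Γ k) ≡ sgn (k ℕ.* k) (detN X (Γ k))
    det-period X = begin
        detN (X ℕ.+ (k ℕ.+ k)) (Γ k)
      ≡⟨ cong (λ z → detN z (Γ k)) (rearrange X k) ⟩
        detN (k ℕ.+ (X ℕ.+ k)) (Γ k)
      ≡⟨ detN-cong (k ℕ.+ (X ℕ.+ k)) (λ i j _ _ → cong (Γ k i) (sym (gap-0 (X ℕ.+ k) j))) ⟩
        detN (k ℕ.+ (X ℕ.+ k)) (λ i j → Γ k i (gap (X ℕ.+ k) 0 j))
      ≡⟨ det-peelRows X k 0 (ℕP.≤-reflexive (ℕP.+-identityʳ k)) ⟩
        sgn (k ℕ.* k) (detN (X ℕ.+ k) (λ i j → Γ k i (gap X (k ℕ.+ 0) j)))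
      ≡⟨ cong (sgn (k ℕ.* k)) (trans (cong (λ z → detN z (λ i j → Γ k i (gap X (k ℕ.+ 0) j))) (ℕP.+-comm X k))
            (detN-cong (k ℕ.+ X) (λ i j _ _ → cong (λ z → Γ k i (gap X z j)) (ℕP.+-identityʳ k)))) ⟩
        sgn (k ℕ.* k) (detN (k ℕ.+ X) (λ i j → Γ k i (gap X k j)))
      ≡⟨ cong (sgn (k ℕ.* k)) (det-peelCols X k ℕP.≤-refl) ⟩
        sgn (k ℕ.* k) (detN X (Γ k)) ∎
      where
      open ≡-Reasoning
      rearrange : ∀ X k → X ℕ.+ (k ℕ.+ k) ≡ k ℕ.+ (X ℕ.+ k)
      rearrange = ℕSolver.solve-∀

    det-period* : ∀ X q → detN (X ℕ.+ q ℕ.* (k ℕ.+ k)) (Γ k) ≡ sgn (k ℕ.* q) (detN X (Γ k))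
    det-period* X q = trans (iterate q) (sgn-parity q (detN X (Γ k)))
      where
      iterate : ∀ q → detN (X ℕ.+ q ℕ.* (k ℕ.+ k)) (Γ k) ≡ sgn (q ℕ.* (k ℕ.* k)) (detN X (Γ k))
      iterate zero    = cong (λ z → detN z (Γ k)) (ℕP.+-identityʳ X)
      iterate (suc q) = begin
          detN (X ℕ.+ suc q ℕ.* (k ℕ.+ k)) (Γ k)
        ≡⟨ cong (λ z → detN z (Γ k)) (one-more X q k) ⟩
          detN ((X ℕ.+ q ℕ.* (k ℕ.+ k)) ℕ.+ (k ℕ.+ k)) (Γ k)
        ≡⟨ det-period (X ℕ.+ q ℕ.* (k ℕ.+ k)) ⟩
          sgn (k ℕ.* k) (detN (X ℕ.+ q ℕ.* (k ℕ.+ k)) (Γ k))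
        ≡⟨ cong (sgn (k ℕ.* k)) (iterate q) ⟩
          sgn (k ℕ.* k) (sgn (q ℕ.* (k ℕ.* k)) (detN X (Γ k)))
        ≡⟨ sym (sgn-+ (k ℕ.* k) (q ℕ.* (k ℕ.* k)) (detN X (Γ k))) ⟩
          sgn (suc q ℕ.* (k ℕ.* k)) (detN X (Γ k)) ∎
        where
        open ≡-Reasoning
        one-more : ∀ X q k → X ℕ.+ suc q ℕ.* (k ℕ.+ k) ≡ (X ℕ.+ q ℕ.* (k ℕ.+ k)) ℕ.+ (k ℕ.+ k)
        one-more = ℕSolver.solve-∀
      sgn-parity : ∀ q x → sgn (q ℕ.* (k ℕ.* k)) x ≡ sgn (k ℕ.* q) x
      sgn-parity q x with square-parity k
      ... | w , e = trans (sgn-cong x (trans (cong (q ℕ.*_) e) (distrib q k w))) (sgn-even (k ℕ.* q) (q ℕ.* w) x)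
        where
        distrib : ∀ q k w → q ℕ.* (k ℕ.+ (w ℕ.+ w)) ≡ k ℕ.* q ℕ.+ (q ℕ.* w ℕ.+ q ℕ.* w)
        distrib = ℕSolver.solve-∀

    -- Blocks of size 0 < M < k have a zero first row.
    det-below-k : ∀ m → suc m < k → detN (suc m) (Γ k) ≡ + 0
    det-below-k m sm<k = detN-zeroRow0 m (Γ k) (λ j j< → Γ-0
        (ℕP.<⇒≢ (ℕP.<-trans j< sm<k))
        (ℕP.<⇒≢ (subst (0 <_) (sym (ℕP.+-suc j k′)) (s≤s z≤n)))
        (ℕP.<⇒≢ (ℕP.≤-<-trans j< sm<k)))

    -- The k × k block is the exchange matrix.
    det-k : detN k (Γ k) ≡ sgn (k C 2) (+ 1)
    det-k = trans (detN-cong k (λ i j i< j< → trans (cong₂ (λ u v → u + v + δ (suc (i ℕ.+ j)) k)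
                (δ-≢ (ℕP.<⇒≢ (ℕP.<-≤-trans j< (ℕP.m≤n+m k i)))) (δ-≢ (ℕP.<⇒≢ (ℕP.<-≤-trans i< (ℕP.m≤n+m k j)))))
                (ℤP.+-identityˡ (δ (suc (i ℕ.+ j)) k)))) (detN-exchange k)

    -- Blocks of size k < M < 2k: after peeling M-k rows the remaining
    -- k × k block has a zero last row.
    det-above-k : ∀ r′ → suc r′ < k → detN (k ℕ.+ suc r′) (Γ k) ≡ + 0
    det-above-k r′ r<k = begin
        detN (k ℕ.+ r) (Γ k)
      ≡⟨ cong (λ z → detN z (Γ k)) (ℕP.+-comm k r) ⟩
        detN (r ℕ.+ (0 ℕ.+ k)) (Γ k)
      ≡⟨ detN-cong (r ℕ.+ k) (λ i j _ _ → cong (Γ k i) (sym (gap-0 r j))) ⟩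
        detN (r ℕ.+ (0 ℕ.+ k)) (λ i j → Γ k i (gap (0 ℕ.+ r) 0 j))
      ≡⟨ det-peelRows 0 r 0 (subst (_≤ k) (sym (ℕP.+-identityʳ r)) (ℕP.<⇒≤ r<k)) ⟩
        sgn (k ℕ.* r) (detN k F)
      ≡⟨ cong (sgn (k ℕ.* r)) (detN-lastRow k′ F 0 z≤n (λ j j≤ _ → last-zero j j≤)) ⟩
        sgn (k ℕ.* r) (sgn (k′ ℕ.+ 0) (F k′ 0 * detN k′ (λ i j → F i (skip 0 j))))
      ≡⟨ cong (sgn (k ℕ.* r)) (sgn-zero-* (k′ ℕ.+ 0) (detN k′ (λ i j → F i (skip 0 j))) (last-zero 0 z≤n)) ⟩
        sgn (k ℕ.* r) (+ 0)
      ≡⟨ sgn-0 (k ℕ.* r) ⟩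
        + 0 ∎
      where
      open ≡-Reasoning
      r = suc r′
      F : ℕ → ℕ → ℤ
      F i j = Γ k i (gap 0 (r ℕ.+ 0) j)
      last-zero : ∀ j → j ≤ k′ → F k′ j ≡ + 0
      last-zero j j≤ = Γ-0
        (ℕP.<⇒≢ (subst (_< k′ ℕ.+ k) (ℕP.+-comm j (r ℕ.+ 0))
                 (ℕP.+-mono-≤-< j≤ (subst (_< k) (sym (ℕP.+-identityʳ r)) r<k))))
        (ℕP.<⇒≢ (ℕP.<-≤-trans (ℕP.n<1+n k′) (ℕP.m≤n+m k (r ℕ.+ 0 ℕ.+ j))))
        (>⇒≢ (s≤s (subst (k ℕ.≤_) (sym (ℕP.+-suc k′ (r′ ℕ.+ 0 ℕ.+ j))) (s≤s (ℕP.m≤m+n k′ _)))))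

    det-other : ∀ m → m < k ℕ.+ k → m ≢ 0 → m ≢ k → detN m (Γ k) ≡ + 0
    det-other zero    _  m≢0 _   = ⊥-elim (m≢0 refl)
    det-other (suc m) lt _   m≢k with ℕP.<-cmp (suc m) k
    ... | tri< m<k _ _ = det-below-k m m<k
    ... | tri≈ _ e _   = ⊥-elim (m≢k e)
    ... | tri> _ _ m>k = above (suc m ∸ k) (sym (ℕP.m+[n∸m]≡n (ℕP.<⇒≤ m>k)))
      where
      above : ∀ d → suc m ≡ k ℕ.+ d → detN (suc m) (Γ k) ≡ + 0
      above zero     e = ⊥-elim (m≢k (trans e (ℕP.+-identityʳ k)))
      above (suc r′) e = trans (cong (λ z → detN z (Γ k)) e)
        (det-above-k r′ (ℕP.+-cancelˡ-< k (suc r′) k (subst (_< k ℕ.+ k) e lt)))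

    det-Γ : ∀ M → ((n : ℕ) → M ≡ 2 ℕ.* k ℕ.* n → detN M (Γ k) ≡ negOnePow (k ℕ.* n))
          × ((n : ℕ) → M ≡ 2 ℕ.* k ℕ.* n ℕ.+ k → detN M (Γ k) ≡ negOnePow (k ℕ.* n ℕ.+ k C 2))
          × (((n : ℕ) → (M ≢ 2 ℕ.* k ℕ.* n) × (M ≢ 2 ℕ.* k ℕ.* n ℕ.+ k)) → detN M (Γ k) ≡ + 0)
    det-Γ M = multiple , multiple+k , otherwise
      where
      size-0 : ∀ k n → 2 ℕ.* k ℕ.* n ≡ 0 ℕ.+ n ℕ.* (k ℕ.+ k)
      size-0 = ℕSolver.solve-∀
      size-k : ∀ k n → 2 ℕ.* k ℕ.* n ℕ.+ k ≡ k ℕ.+ n ℕ.* (k ℕ.+ k)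
      size-k = ℕSolver.solve-∀
      multiple : (n : ℕ) → M ≡ 2 ℕ.* k ℕ.* n → detN M (Γ k) ≡ negOnePow (k ℕ.* n)
      multiple n e = trans (cong (λ z → detN z (Γ k)) (trans e (size-0 k n)))
                           (trans (det-period* 0 n) (sgn-1 (k ℕ.* n)))
      multiple+k : (n : ℕ) → M ≡ 2 ℕ.* k ℕ.* n ℕ.+ k → detN M (Γ k) ≡ negOnePow (k ℕ.* n ℕ.+ k C 2)
      multiple+k n e = trans (cong (λ z → detN z (Γ k)) (trans e (size-k k n)))
                             (trans (det-period* k n) (trans (cong (sgn (k ℕ.* n)) det-k)
                               (trans (sym (sgn-+ (k ℕ.* n) (k C 2) (+ 1))) (sgn-1 (k ℕ.* n ℕ.+ k C 2)))))
      otherwise : ((n : ℕ) → (M ≢ 2 ℕ.* k ℕ.* n) × (M ≢ 2 ℕ.* k ℕ.* n ℕ.+ k)) → detN M (Γ k) ≡ + 0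
      otherwise h = trans (cong (λ z → detN z (Γ k)) M≡)
                          (trans (det-period* rem q) (trans (cong (sgn (k ℕ.* q)) rem-zero) (sgn-0 (k ℕ.* q))))
        where
        rem = M % (k ℕ.+ k)
        q = M / (k ℕ.+ k)
        M≡ : M ≡ rem ℕ.+ q ℕ.* (k ℕ.+ k)
        M≡ = m≡m%n+[m/n]*n M (k ℕ.+ k)
        rem-zero : detN rem (Γ k) ≡ + 0
        rem-zero = det-other rem (m%n<n M (k ℕ.+ k))
          (λ e → proj₁ (h q) (trans M≡ (trans (cong (ℕ._+ q ℕ.* (k ℕ.+ k)) e) (sym (size-0 k q)))))
          (λ e → proj₂ (h q) (trans M≡ (trans (cong (ℕ._+ q ℕ.* (k ℕ.+ k)) e) (sym (size-k k q)))))

  -- Γ(k+2) = γ Γ(k+1) - Γ k, read off row by row: row i+1 of γ·M is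
  -- M(i+2) + M(i), row 0 is M(1) + M(0).
  Γ-rec : ∀ k i j → Γ (suc (suc k)) (suc i) j ≡ Γ (suc k) (suc (suc i)) j + Γ (suc k) i j - Γ k (suc i) j
  Γ-rec k i j = begin
      δ j (suc i ℕ.+ suc (suc k)) + δ (suc i) (j ℕ.+ suc (suc k)) + δ (i ℕ.+ j) k
    ≡⟨ cong₂ (λ u v → u + v + δ (i ℕ.+ j) k) (δʳ j (+-2 (suc i) k)) (δʳ (suc i) (+-2 j k)) ⟩
      a1 + a2 + a3
    ≡⟨ regroup a1 a2 a3 a4 a5 a6 ⟩
      (a1 + a4 + a5) + (a6 + a2 + a3) - (a6 + a4 + a5)
    ≡⟨ sym (cong₂ (λ u v → u + v - (a6 + a4 + a5))
              (cong₂ (λ x y → x + y + a5) (δʳ j (+-1 (suc (suc i)) k)) (δʳ (suc (suc i)) (+-1 j k)))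
              (cong₂ (λ x y → x + y + a3) (δʳ j (+-1 i k)) (δʳ i (+-1 j k)))) ⟩
      Γ (suc k) (suc (suc i)) j + Γ (suc k) i j - Γ k (suc i) j ∎
    where
    open ≡-Reasoning
    a1 = δ j (suc (suc (suc (i ℕ.+ k))))
    a2 = δ i (suc (j ℕ.+ k))
    a3 = δ (i ℕ.+ j) k
    a4 = δ (suc i) (j ℕ.+ k)
    a5 = δ (suc (suc (i ℕ.+ j))) k
    a6 = δ j (suc (i ℕ.+ k))
    +-1 : ∀ j k → j ℕ.+ suc k ≡ suc (j ℕ.+ k)
    +-1 = ℕP.+-suc
    +-2 : ∀ j k → j ℕ.+ suc (suc k) ≡ suc (suc (j ℕ.+ k))
    +-2 j k = trans (ℕP.+-suc j (suc k)) (cong suc (ℕP.+-suc j k))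
    regroup : ∀ a1 a2 a3 a4 a5 a6 → a1 + a2 + a3 ≡ (a1 + a4 + a5) + (a6 + a2 + a3) - (a6 + a4 + a5)
    regroup = solve-∀

  Γ-rec₀ : ∀ k j → Γ (suc (suc k)) 0 j ≡ Γ (suc k) 1 j + Γ (suc k) 0 j - Γ k 0 j
  Γ-rec₀ k j = begin
      c1 + δ 0 (j ℕ.+ suc (suc k)) + c2
    ≡⟨ cong (λ u → c1 + u + c2) (δʳ 0 (ℕP.+-suc j (suc k))) ⟩
      c1 + + 0 + c2
    ≡⟨ regroup c1 c2 c3 c4 c5 ⟩
      (c1 + c3 + c4) + (c2 + + 0 + c5) - (c5 + c3 + c4)
    ≡⟨ sym (cong₂ (λ u v → (c1 + u + c4) + (c2 + v + c5) - (c5 + c3 + c4))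
                  (δʳ 1 (ℕP.+-suc j k)) (δʳ 0 (ℕP.+-suc j k))) ⟩
      Γ (suc k) 1 j + Γ (suc k) 0 j - Γ k 0 j ∎
    where
    open ≡-Reasoning
    c1 = δ j (suc (suc k))
    c2 = δ j (suc k)
    c3 = δ 0 (j ℕ.+ k)
    c4 = δ (suc j) k
    c5 = δ j k
    regroup : ∀ c1 c2 c3 c4 c5 → c1 + + 0 + c2 ≡ (c1 + c3 + c4) + (c2 + + 0 + c5) - (c5 + c3 + c4)
    regroup = solve-∀

  -- The folded pattern of b_k(α_N) (ε = 1) and b_k(β_N) (ε = -1): Γ k plus
  -- ε on the anti-diagonal i + j = 2N - 1 - k.
  Γε : ℤ → ℕ → ℕ → ℕ → ℕ → ℤ
  Γε ε N k i j = Γ k i j + ε * δ (suc (i ℕ.+ j ℕ.+ k)) (N ℕ.+ N)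

  Γε-cong : ∀ ε N k i j {x y z w} → δ j (i ℕ.+ k) ≡ x → δ i (j ℕ.+ k) ≡ y → δ (suc (i ℕ.+ j)) k ≡ z →
            δ (suc (i ℕ.+ j ℕ.+ k)) (N ℕ.+ N) ≡ w → Γε ε N k i j ≡ x + y + z + ε * w
  Γε-cong ε N k i j refl refl refl refl = refl

  Γε-rec : ∀ ε N k i j → Γε ε N (suc (suc k)) (suc i) j
           ≡ Γε ε N (suc k) (suc (suc i)) j + Γε ε N (suc k) i j - Γε ε N k (suc i) j
  Γε-rec ε N k i j = begin
      Γ (suc (suc k)) (suc i) j + ε * δ (suc (suc i ℕ.+ j ℕ.+ suc (suc k))) NN
    ≡⟨ cong₂ (λ u v → u + ε * v) (Γ-rec k i j) (δˡ NN (+4 i j k)) ⟩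
      (a + b′ - c) + ε * x
    ≡⟨ regroup a b′ c ε x y ⟩
      (a + ε * x) + (b′ + ε * y) - (c + ε * y)
    ≡⟨ sym (cong₂ (λ u v → (a + ε * u) + (b′ + ε * v) - (c + ε * y)) (δˡ NN (+4′ i j k)) (δˡ NN (+2 i j k))) ⟩
      Γε ε N (suc k) (suc (suc i)) j + Γε ε N (suc k) i j - Γε ε N k (suc i) j ∎
    where
    open ≡-Reasoning
    NN = N ℕ.+ N
    a  = Γ (suc k) (suc (suc i)) j
    b′ = Γ (suc k) i j
    c  = Γ k (suc i) j
    x = δ (suc (suc (suc (suc (i ℕ.+ j ℕ.+ k))))) NN
    y = δ (suc (suc (i ℕ.+ j ℕ.+ k))) NN
    +4 : ∀ i j k → suc (suc i ℕ.+ j ℕ.+ suc (suc k)) ≡ suc (suc (suc (suc (i ℕ.+ j ℕ.+ k))))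
    +4 = ℕSolver.solve-∀
    +4′ : ∀ i j k → suc (suc (suc i) ℕ.+ j ℕ.+ suc k) ≡ suc (suc (suc (suc (i ℕ.+ j ℕ.+ k))))
    +4′ = ℕSolver.solve-∀
    +2 : ∀ i j k → suc (i ℕ.+ j ℕ.+ suc k) ≡ suc (suc (i ℕ.+ j ℕ.+ k))
    +2 = ℕSolver.solve-∀
    regroup : ∀ a b c e x y → (a + b - c) + e * x ≡ (a + e * x) + (b + e * y) - (c + e * y)
    regroup = solve-∀

  Γε-rec₀ : ∀ ε N k j → δ (suc (suc (j ℕ.+ k))) (N ℕ.+ N) ≡ + 0 → δ (suc (j ℕ.+ k)) (N ℕ.+ N) ≡ + 0 →
            Γε ε N (suc (suc k)) 0 j ≡ Γε ε N (suc k) 1 j + Γε ε N (suc k) 0 j - Γε ε N k 0 j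
  Γε-rec₀ ε N k j far₂ far₁ = begin
      Γ (suc (suc k)) 0 j + ε * δ (suc (j ℕ.+ suc (suc k))) NN
    ≡⟨ cong₂ (λ u v → u + ε * v) (Γ-rec₀ k j) (δˡ NN (+3 j k)) ⟩
      (a + b′ - c) + ε * x
    ≡⟨ regroup a b′ c ε x ⟩
      (a + ε * x) + (b′ + ε * + 0) - (c + ε * + 0)
    ≡⟨ sym (cong₃ (δˡ NN (+3′ j k)) (trans (δˡ NN (cong suc (ℕP.+-suc j k))) far₂) far₁) ⟩
      Γε ε N (suc k) 1 j + Γε ε N (suc k) 0 j - Γε ε N k 0 j ∎
    where
    open ≡-Reasoning
    NN = N ℕ.+ N
    a  = Γ (suc k) 1 j
    b′ = Γ (suc k) 0 j
    c  = Γ k 0 j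
    x = δ (suc (suc (suc (j ℕ.+ k)))) NN
    +3 : ∀ j k → suc (j ℕ.+ suc (suc k)) ≡ suc (suc (suc (j ℕ.+ k)))
    +3 = ℕSolver.solve-∀
    +3′ : ∀ j k → suc (suc (j ℕ.+ suc k)) ≡ suc (suc (suc (j ℕ.+ k)))
    +3′ = ℕSolver.solve-∀
    cong₃ : ∀ {u u′ v v′ w w′} → u ≡ u′ → v ≡ v′ → w ≡ w′ →
            (a + ε * u) + (b′ + ε * v) - (c + ε * w) ≡ (a + ε * u′) + (b′ + ε * v′) - (c + ε * w′)
    cong₃ refl refl refl = refl
    regroup : ∀ a b c e x → (a + b - c) + e * x ≡ (a + e * x) + (b + e * + 0) - (c + e * + 0)
    regroup = solve-∀

  δ-cancel : ∀ a {c d} x y → c ≡ a ℕ.+ x → d ≡ a ℕ.+ y → δ c d ≡ δ x y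
  δ-cancel a x y refl refl = δ-+ a x y

  lastRow-corners : ∀ m j k → let n = suc (suc m) ; N = suc n in
      (δ (suc (n ℕ.+ j ℕ.+ suc (suc k))) (N ℕ.+ N) ≡ δ n (suc (j ℕ.+ k)))
    × (δ (suc (suc m ℕ.+ j ℕ.+ suc k)) (N ℕ.+ N) ≡ δ (j ℕ.+ k) (suc n))
    × (δ (suc (n ℕ.+ j ℕ.+ suc k)) (N ℕ.+ N) ≡ δ n (j ℕ.+ k))
    × (δ (suc (n ℕ.+ j ℕ.+ k)) (N ℕ.+ N) ≡ δ (j ℕ.+ k) (suc n))
  lastRow-corners m j k =
      trans (δ-cancel n (suc (suc (suc (j ℕ.+ k)))) (suc (suc n)) (e₀ n j k) (NN n)) (δ-sym (suc (j ℕ.+ k)) n)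
    , δ-cancel (suc m) (suc (suc (j ℕ.+ k))) (suc (suc (suc n))) (e₁ m j k) (NN′ m)
    , trans (δ-cancel n (suc (suc (j ℕ.+ k))) (suc (suc n)) (e₂ n j k) (NN n)) (δ-sym (j ℕ.+ k) n)
    , δ-cancel (suc m) (suc (suc (j ℕ.+ k))) (suc (suc (suc n))) (e₃ m j k) (NN′ m)
    where
    n = suc (suc m)
    NN : ∀ n → suc n ℕ.+ suc n ≡ n ℕ.+ suc (suc n)
    NN = ℕSolver.solve-∀
    NN′ : ∀ m → suc (suc (suc m)) ℕ.+ suc (suc (suc m)) ≡ suc m ℕ.+ suc (suc (suc (suc (suc m))))
    NN′ = ℕSolver.solve-∀
    e₀ : ∀ n j k → suc (n ℕ.+ j ℕ.+ suc (suc k)) ≡ n ℕ.+ suc (suc (suc (j ℕ.+ k)))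
    e₀ = ℕSolver.solve-∀
    e₁ : ∀ m j k → suc (suc m ℕ.+ j ℕ.+ suc k) ≡ suc m ℕ.+ suc (suc (j ℕ.+ k))
    e₁ = ℕSolver.solve-∀
    e₂ : ∀ n j k → suc (n ℕ.+ j ℕ.+ suc k) ≡ n ℕ.+ suc (suc (j ℕ.+ k))
    e₂ = ℕSolver.solve-∀
    e₃ : ∀ m j k → suc (suc (suc m) ℕ.+ j ℕ.+ k) ≡ suc m ℕ.+ suc (suc (j ℕ.+ k))
    e₃ = ℕSolver.solve-∀

  lastRow-algebra : ∀ ε → ε * ε ≡ + 1 → ∀ A1 A2 A3 A4 A6 →
    + 0 + A2 + + 0 + ε * A3
      ≡ (A1 + A2 + + 0 + ε * A6) + ε * (+ 0 + A3 + + 0 + ε * A4) - (A1 + A4 + + 0 + ε * A6)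
  lastRow-algebra ε εε A1 A2 A3 A4 A6 =
    trans (expand A2 ε A3 A4) (trans (cong (λ z → A2 + ε * A3 + z * A4 - A4) (sym εε)) (collect A1 A2 A3 A4 A6 ε))
    where
    expand : ∀ g e h3 h4 → + 0 + g + + 0 + e * h3 ≡ g + e * h3 + + 1 * h4 - h4
    expand = solve-∀
    collect : ∀ A1 A2 A3 A4 A6 e → A2 + e * A3 + (e * e) * A4 - A4
            ≡ (A1 + A2 + + 0 + e * A6) + e * (+ 0 + A3 + + 0 + e * A4) - (A1 + A4 + + 0 + e * A6)
    collect = solve-∀

  -- Row n = N - 1 of α_N, β_N has 1 in column n - 1 and ε on the
  -- diagonal, and correspondingly Γε(k+2)(n) = Γε(k+1)(n-1) + ε Γε(k+1)(n) - Γε k (n).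
  Γε-recLast : ∀ ε n m k j → n ≡ suc (suc m) → ε * ε ≡ + 1 → j ≤ n → suc (suc k) ≤ n →
    Γε ε (suc n) (suc (suc k)) n j
      ≡ Γε ε (suc n) (suc k) (suc m) j + ε * Γε ε (suc n) (suc k) n j - Γε ε (suc n) k n j
  Γε-recLast ε .(suc (suc m)) m k j refl εε j≤n k+2≤n = begin
      Γε ε N (suc (suc k)) n j
    ≡⟨ Γε-cong ε N (suc (suc k)) n j (δ-≢ (j≢n+ (suc k))) (δʳ n (+-2 j k))
               (δ-≢ (>⇒≢ (s≤s (ℕP.≤-trans k+2≤n (ℕP.m≤m+n n j))))) corner₀ ⟩
      + 0 + A2 + + 0 + ε * A3
    ≡⟨ lastRow-algebra ε εε A1 A2 A3 A4 A6 ⟩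
      (A1 + A2 + + 0 + ε * A6) + ε * (+ 0 + A3 + + 0 + ε * A4) - (A1 + A4 + + 0 + ε * A6)
    ≡⟨ sym (cong₃
         (Γε-cong ε N (suc k) (suc m) j (δʳ j (ℕP.+-suc (suc m) k)) (δʳ (suc m) (ℕP.+-suc j k))
                  (δ-≢ (>⇒≢ (s≤s (ℕP.≤-trans k+1≤m+1 (ℕP.m≤m+n (suc m) j))))) corner₁)
         (Γε-cong ε N (suc k) n j (δ-≢ (j≢n+ k)) (δʳ n (ℕP.+-suc j k))
                  (δ-≢ (>⇒≢ (s≤s (ℕP.≤-trans (ℕP.m≤n⇒m≤1+n k+1≤m+1) (ℕP.m≤m+n n j))))) corner₂)
         (Γε-cong ε N k n j refl refl
                  (δ-≢ (>⇒≢ (s≤s (ℕP.≤-trans (ℕP.≤-trans (ℕP.n≤1+n k) (ℕP.m≤n⇒m≤1+n k+1≤m+1)) (ℕP.m≤m+n n j)))))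
                  corner₃)) ⟩
      Γε ε N (suc k) (suc m) j + ε * Γε ε N (suc k) n j - Γε ε N k n j ∎
    where
    open ≡-Reasoning
    n = suc (suc m)
    N = suc n
    k+1≤m+1 : suc k ≤ suc m
    k+1≤m+1 = ℕP.≤-pred k+2≤n
    A1 = δ j (n ℕ.+ k)
    A2 = δ n (suc (suc (j ℕ.+ k)))
    A3 = δ n (suc (j ℕ.+ k))
    A4 = δ n (j ℕ.+ k)
    A6 = δ (j ℕ.+ k) (suc n)
    +-2 : ∀ j k → j ℕ.+ suc (suc k) ≡ suc (suc (j ℕ.+ k))
    +-2 = ℕSolver.solve-∀
    j≢n+ : ∀ x → j ≢ n ℕ.+ suc x
    j≢n+ x = ℕP.<⇒≢ (ℕP.≤-<-trans j≤n (ℕP.m<m+n n (s≤s z≤n)))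
    corner₀ : δ (suc (n ℕ.+ j ℕ.+ suc (suc k))) (N ℕ.+ N) ≡ A3
    corner₀ = proj₁ (lastRow-corners m j k)
    corner₁ : δ (suc (suc m ℕ.+ j ℕ.+ suc k)) (N ℕ.+ N) ≡ A6
    corner₁ = proj₁ (proj₂ (lastRow-corners m j k))
    corner₂ : δ (suc (n ℕ.+ j ℕ.+ suc k)) (N ℕ.+ N) ≡ A4
    corner₂ = proj₁ (proj₂ (proj₂ (lastRow-corners m j k)))
    corner₃ : δ (suc (n ℕ.+ j ℕ.+ k)) (N ℕ.+ N) ≡ A6
    corner₃ = proj₂ (proj₂ (proj₂ (lastRow-corners m j k)))
    cong₃ : ∀ {u u′ v v′ w w′ : ℤ} → u ≡ u′ → v ≡ v′ → w ≡ w′ → u + ε * v - w ≡ u′ + ε * v′ - w′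
    cong₃ refl refl refl = refl

  -- b_k(α_N) and b_k(β_N)

  -- A is α_N (ε = 1) or β_N (ε = -1), given through its entries.  Its
  -- Lucas matrices are the folded patterns Γε as long as k < N.
  module FoldedLucas (n : ℕ) (A : Mat (suc n) (suc n)) (ε : ℤ) (εε : ε * ε ≡ + 1)
                     (entA : ∀ i j → A i j ≡ Sε ε (suc n) (toℕ i) (toℕ j)) where

    N = suc n

    act : (Fin N → Fin N → ℤ) → Fin N → Fin N → ℤ
    act f i j = sumFin N (λ l → A i l * f l j)

    act-cong : ∀ f g → (∀ i j → f i j ≡ g i j) → ∀ i j → act f i j ≡ act g i j
    act-cong f g e i j = sumFin-cong N (λ l → cong (A i l *_) (e l j))

    act-lin : ∀ a b f g i j → act (λ x y → a * f x y + b * g x y) i j ≡ a * act f i j + b * act g i j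
    act-lin a b f g i j = begin
        sumFin N (λ l → A i l * (a * f l j + b * g l j))
      ≡⟨ sumFin-cong N (λ l → distribute (A i l) a b (f l j) (g l j)) ⟩
        sumFin N (λ l → a * (A i l * f l j) + b * (A i l * g l j))
      ≡⟨ sumFin-+ N (λ l → a * (A i l * f l j)) (λ l → b * (A i l * g l j)) ⟩
        sumFin N (λ l → a * (A i l * f l j)) + sumFin N (λ l → b * (A i l * g l j))
      ≡⟨ cong₂ _+_ (sumFin-* N a (λ l → A i l * f l j)) (sumFin-* N b (λ l → A i l * g l j)) ⟩
        a * act f i j + b * act g i j ∎
      where
      open ≡-Reasoning
      distribute : ∀ x a b u v → x * (a * u + b * v) ≡ a * (x * u) + b * (x * v)
      distribute = solve-∀

    open PolyAction (Fin N) (idM N) act act-cong act-lin (λ p → evalMat N p A) (λ i j → refl) (λ c cs i j → refl) public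

    open ≡-Reasoning

    corner-far : ∀ {a b} → a < N → b < N → suc (a ℕ.+ b) < N ℕ.+ N
    corner-far {a} a<N b<N = ℕP.<-≤-trans (s≤s (ℕP.+-monoʳ-< a (ℕP.n<1+n _))) (ℕP.+-mono-≤ a<N b<N)

    lucas-0 : ∀ i j → lucas 0 i j ≡ Γε ε N 0 (toℕ i) (toℕ j)
    lucas-0 i j = begin
        + 2 * δ x y
      ≡⟨ double (δ x y) ε ⟩
        δ x y + δ x y + + 0 + ε * + 0
      ≡⟨ sym (Γε-cong ε N 0 x y (trans (δʳ y (ℕP.+-identityʳ x)) (δ-sym y x)) (δʳ x (ℕP.+-identityʳ y)) refl
               (δ-≢ (ℕP.<⇒≢ (subst (_< N ℕ.+ N) (cong suc (sym (ℕP.+-identityʳ (x ℕ.+ y))))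
                                  (corner-far (FinP.toℕ<n i) (FinP.toℕ<n j)))))) ⟩
        Γε ε N 0 x y ∎
      where
      x = toℕ i
      y = toℕ j
      double : ∀ d e → + 2 * d ≡ d + d + + 0 + e * + 0
      double = solve-∀

    Sε≡Γε1 : ∀ x y → x < N → y < N → Sε ε N x y ≡ Γε ε N 1 x y
    Sε≡Γε1 x y x<N y<N = begin
        δ y (suc x) + δ x (suc y) + δ x 0 * δ y 0 + ε * (δ x n * δ y n)
      ≡⟨ cong₂ (λ u v → δ y (suc x) + δ x (suc y) + u + ε * v) (origin x y) last ⟩
        δ y (suc x) + δ x (suc y) + δ (x ℕ.+ y) 0 + ε * δ (suc (x ℕ.+ y ℕ.+ 1)) (N ℕ.+ N)
      ≡⟨ cong₂ (λ u v → u + v + δ (x ℕ.+ y) 0 + ε * δ (suc (x ℕ.+ y ℕ.+ 1)) (N ℕ.+ N))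
               (δʳ y (ℕP.+-comm 1 x)) (δʳ x (ℕP.+-comm 1 y)) ⟩
        Γε ε N 1 x y ∎
      where
      origin : ∀ x y → δ x 0 * δ y 0 ≡ δ (x ℕ.+ y) 0
      origin zero    y = ℤP.*-identityˡ (δ y 0)
      origin (suc x) y = refl
      +1+1 : ∀ x y n → x ℕ.+ y < n ℕ.+ n → suc (x ℕ.+ y ℕ.+ 1) < suc n ℕ.+ suc n
      +1+1 x y n lt = subst₂ _<_ (sym (e₁ x y)) (sym (e₂ n)) (s≤s (s≤s lt))
        where
        e₁ : ∀ x y → suc (x ℕ.+ y ℕ.+ 1) ≡ suc (suc (x ℕ.+ y))
        e₁ = ℕSolver.solve-∀
        e₂ : ∀ n → suc n ℕ.+ suc n ≡ suc (suc (n ℕ.+ n))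
        e₂ = ℕSolver.solve-∀
      -- both indices are N - 1 exactly when x + y + 2 = 2N
      last : δ x n * δ y n ≡ δ (suc (x ℕ.+ y ℕ.+ 1)) (N ℕ.+ N)
      last with x ℕ.≟ n | y ℕ.≟ n
      ... | yes refl | yes refl = trans (cong₂ _*_ (δ-refl x) (δ-refl x)) (sym (δ-≡ (e x)))
        where
        e : ∀ x → suc (x ℕ.+ x ℕ.+ 1) ≡ suc x ℕ.+ suc x
        e = ℕSolver.solve-∀
      ... | no x≢n | _ = trans (cong (_* δ y n) (δ-≢ x≢n)) (sym (δ-≢ (ℕP.<⇒≢ (+1+1 x y n
              (ℕP.+-mono-<-≤ (ℕP.≤∧≢⇒< (ℕP.≤-pred x<N) x≢n) (ℕP.≤-pred y<N))))))
      ... | yes _ | no y≢n = trans (cong (δ x n *_) (δ-≢ y≢n)) (trans (ℤP.*-zeroʳ (δ x n)) (sym (δ-≢ (ℕP.<⇒≢ (+1+1 x y n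
              (ℕP.+-mono-≤-< (ℕP.≤-pred x<N) (ℕP.≤∧≢⇒< (ℕP.≤-pred y<N) y≢n)))))))

    lucas-1 : ∀ i j → lucas 1 i j ≡ Γε ε N 1 (toℕ i) (toℕ j)
    lucas-1 i j = begin
        sumFin N (λ l → A i l * idM N l j)
      ≡⟨ sumFin-cong N (λ l → trans (cong (_* idM N l j) (entA i l)) (ℤP.*-comm (Sε ε N (toℕ i) (toℕ l)) (idM N l j))) ⟩
        ΣN N (λ l → δ l (toℕ j) * Sε ε N (toℕ i) l)
      ≡⟨ ΣN-δ N (toℕ j) (Sε ε N (toℕ i)) (FinP.toℕ<n j) ⟩
        Sε ε N (toℕ i) (toℕ j)
      ≡⟨ Sε≡Γε1 (toℕ i) (toℕ j) (FinP.toℕ<n i) (FinP.toℕ<n j) ⟩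
        Γε ε N 1 (toℕ i) (toℕ j) ∎

    rowSum : ℕ → (ℕ → ℤ) → ℤ
    rowSum a T = ΣN N (λ l → Sε ε N a l * T l)

    rowSum-split : ∀ a (T : ℕ → ℤ) → rowSum a T
      ≡ ΣN N (λ l → δ l (suc a) * T l) + ΣN N (λ l → δ a (suc l) * T l)
        + δ a 0 * ΣN N (λ l → δ l 0 * T l) + ε * (δ (suc a) N * ΣN N (λ l → δ (suc l) N * T l))
    rowSum-split a T = begin
        ΣN N (λ l → Sε ε N a l * T l)
      ≡⟨ ΣN-cong N (λ l _ → distribute (δ l (suc a)) (δ a (suc l)) (δ a 0) (δ l 0) ε (δ (suc a) N) (δ (suc l) N) (T l)) ⟩
        ΣN N (λ l → (f1 l + f2 l + δ a 0 * f3 l) + ε * (δ (suc a) N * f4 l))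
      ≡⟨ ΣN-+ N (λ l → f1 l + f2 l + δ a 0 * f3 l) (λ l → ε * (δ (suc a) N * f4 l)) ⟩
        ΣN N (λ l → f1 l + f2 l + δ a 0 * f3 l) + ΣN N (λ l → ε * (δ (suc a) N * f4 l))
      ≡⟨ cong₂ _+_ (trans (ΣN-+ N (λ l → f1 l + f2 l) (λ l → δ a 0 * f3 l)) (cong₂ _+_ (ΣN-+ N f1 f2) (ΣN-* N (δ a 0) f3)))
                   (trans (ΣN-* N ε (λ l → δ (suc a) N * f4 l)) (cong (ε *_) (ΣN-* N (δ (suc a) N) f4))) ⟩
        ΣN N f1 + ΣN N f2 + δ a 0 * ΣN N f3 + ε * (δ (suc a) N * ΣN N f4) ∎
      where
      f1 f2 f3 f4 : ℕ → ℤ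
      f1 l = δ l (suc a) * T l
      f2 l = δ a (suc l) * T l
      f3 l = δ l 0 * T l
      f4 l = δ (suc l) N * T l
      distribute : ∀ p q c r e d w t → (p + q + c * r + e * (d * w)) * t
                                      ≡ (p * t + q * t + c * (r * t)) + e * (d * (w * t))
      distribute = solve-∀

    pick-pred : ∀ a (T : ℕ → ℤ) → a < N → ΣN N (λ l → δ (suc a) (suc l) * T l) ≡ T a
    pick-pred a T lt = trans (ΣN-cong N (λ l _ → cong (_* T l) (δ-sym a l))) (ΣN-δ N a T lt)

    row-first : ∀ (T : ℕ → ℤ) → 1 ≤ n → rowSum 0 T ≡ T 1 + T 0
    row-first T 1≤n = begin
        rowSum 0 T
      ≡⟨ rowSum-split 0 T ⟩
        ΣN N (λ l → δ l 1 * T l) + ΣN N (λ l → δ 0 (suc l) * T l) + δ 0 0 * ΣN N (λ l → δ l 0 * T l) + ε * (δ 1 N * Last)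
      ≡⟨ cong₃ (ΣN-δ N 1 T (s≤s 1≤n)) (ΣN-0 N (λ l → δ 0 (suc l) * T l) (λ l _ → ℤP.*-zeroˡ (T l)))
               (ΣN-δ N 0 T (s≤s z≤n)) (δ-≢ (λ e → ℕP.<⇒≢ 1≤n (ℕP.suc-injective e))) ⟩
        T 1 + + 0 + + 1 * T 0 + ε * (+ 0 * Last)
      ≡⟨ simplify (T 1) (T 0) ε Last ⟩
        T 1 + T 0 ∎
      where
      Last = ΣN N (λ l → δ (suc l) N * T l)
      cong₃ : ∀ {a a′ b b′ c c′ d d′} → a ≡ a′ → b ≡ b′ → c ≡ c′ → d ≡ d′ →
              a + b + + 1 * c + ε * (d * Last) ≡ a′ + b′ + + 1 * c′ + ε * (d′ * Last)
      cong₃ refl refl refl refl = refl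
      simplify : ∀ a b e s → a + + 0 + + 1 * b + e * (+ 0 * s) ≡ a + b
      simplify = solve-∀

    row-interior : ∀ a (T : ℕ → ℤ) → suc a < n → rowSum (suc a) T ≡ T (suc (suc a)) + T a
    row-interior a T lt = begin
        rowSum (suc a) T
      ≡⟨ rowSum-split (suc a) T ⟩
        ΣN N (λ l → δ l (suc (suc a)) * T l) + ΣN N (λ l → δ (suc a) (suc l) * T l) + + 0 * First
          + ε * (δ (suc (suc a)) N * Last)
      ≡⟨ cong₃ (ΣN-δ N (suc (suc a)) T (s≤s lt)) (pick-pred a T (ℕP.<-trans (ℕP.n<1+n a) (ℕP.<-trans lt (ℕP.n<1+n n))))
               (δ-≢ (ℕP.<⇒≢ lt)) ⟩
        T (suc (suc a)) + T a + + 0 * First + ε * (+ 0 * Last)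
      ≡⟨ simplify (T (suc (suc a))) (T a) ε First Last ⟩
        T (suc (suc a)) + T a ∎
      where
      First = ΣN N (λ l → δ l 0 * T l)
      Last = ΣN N (λ l → δ (suc l) N * T l)
      cong₃ : ∀ {a a′ b b′ d d′} → a ≡ a′ → b ≡ b′ → d ≡ d′ →
              a + b + + 0 * First + ε * (d * Last) ≡ a′ + b′ + + 0 * First + ε * (d′ * Last)
      cong₃ refl refl refl = refl
      simplify : ∀ a b e s t → a + b + + 0 * s + e * (+ 0 * t) ≡ a + b
      simplify = solve-∀

    row-last : ∀ a (T : ℕ → ℤ) → suc a ≡ n → rowSum (suc a) T ≡ T a + ε * T n
    row-last a T e = begin
        rowSum (suc a) T
      ≡⟨ rowSum-split (suc a) T ⟩
        ΣN N (λ l → δ l (suc (suc a)) * T l) + ΣN N (λ l → δ (suc a) (suc l) * T l) + + 0 * First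
          + ε * (δ (suc (suc a)) N * ΣN N (λ l → δ (suc l) N * T l))
      ≡⟨ cong₃ (ΣN-δ-out N (suc (suc a)) T (ℕP.≤-reflexive (cong suc (sym e))))
               (pick-pred a T (s≤s (ℕP.≤-trans (ℕP.n≤1+n a) (ℕP.≤-reflexive e))))
               (δ-≡ e) (ΣN-δ N n T (ℕP.n<1+n n)) ⟩
        + 0 + T a + + 0 * First + ε * (+ 1 * T n)
      ≡⟨ simplify (T a) ε First (T n) ⟩
        T a + ε * T n ∎
      where
      First = ΣN N (λ l → δ l 0 * T l)
      cong₃ : ∀ {a a′ b b′ d d′ s s′} → a ≡ a′ → b ≡ b′ → d ≡ d′ → s ≡ s′ →
              a + b + + 0 * First + ε * (d * s) ≡ a′ + b′ + + 0 * First + ε * (d′ * s′)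
      cong₃ refl refl refl refl = refl
      simplify : ∀ b e s t → + 0 + b + + 0 * s + e * (+ 1 * t) ≡ b + e * t
      simplify = solve-∀

    step : ∀ k → suc (suc k) < N → ∀ x y → x < N → y < N →
           rowSum x (λ l → Γε ε N (suc k) l y) - Γε ε N k x y ≡ Γε ε N (suc (suc k)) x y
    step k lt zero y _ y<N =
      trans (cong (_- Γε ε N k 0 y) (row-first (λ l → Γε ε N (suc k) l y) 1≤n))
            (sym (Γε-rec₀ ε N k y (δ-≢ (ℕP.<⇒≢ far₂)) (δ-≢ (ℕP.<⇒≢ (ℕP.<-trans (ℕP.n<1+n _) far₂)))))
      where
      1≤n : 1 ≤ n
      1≤n = ℕP.≤-trans (s≤s z≤n) (ℕP.≤-pred lt)
      +2 : ∀ y k → y ℕ.+ suc (suc k) ≡ suc (suc (y ℕ.+ k))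
      +2 = ℕSolver.solve-∀
      far₂ : suc (suc (y ℕ.+ k)) < N ℕ.+ N
      far₂ = subst (_< N ℕ.+ N) (+2 y k) (ℕP.+-mono-< y<N lt)
    step k lt (suc a) y a+1<N y<N with suc a ℕ.<? n
    ... | yes a+1<n = trans (cong (_- Γε ε N k (suc a) y) (row-interior a (λ l → Γε ε N (suc k) l y) a+1<n)) (sym (Γε-rec ε N k a y))
    ... | no  a+1≮n = last-row a (ℕP.≤-antisym (ℕP.≤-pred a+1<N) (ℕP.≮⇒≥ a+1≮n))
      where
      column : ℕ → ℤ
      column l = Γε ε N (suc k) l y
      last-row : ∀ a → suc a ≡ n → rowSum (suc a) column - Γε ε N k (suc a) y ≡ Γε ε N (suc (suc k)) (suc a) y
      last-row zero    refl = ⊥-elim (ℕP.<-irrefl refl (ℕP.≤-trans lt (s≤s (s≤s z≤n))))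
      last-row (suc m) e    = begin
          rowSum (suc (suc m)) column - Γε ε N k (suc (suc m)) y
        ≡⟨ cong₂ _-_ (row-last (suc m) column e) (cong (λ z → Γε ε N k z y) e) ⟩
          column (suc m) + ε * column n - Γε ε N k n y
        ≡⟨ sym (Γε-recLast ε n m k y (sym e) εε (ℕP.≤-pred y<N) (ℕP.≤-pred lt)) ⟩
          Γε ε N (suc (suc k)) n y
        ≡⟨ cong (λ z → Γε ε N (suc (suc k)) z y) (sym e) ⟩
          Γε ε N (suc (suc k)) (suc (suc m)) y ∎

    lucas≡Γε : ∀ k → k < N → ∀ i j → lucas k i j ≡ Γε ε N k (toℕ i) (toℕ j)
    lucas≡Γε k k<N = proj₁ (pair k k<N)
      where
      pair : ∀ k → k < N → (∀ i j → lucas k i j ≡ Γε ε N k (toℕ i) (toℕ j))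
                         × (suc k < N → ∀ i j → lucas (suc k) i j ≡ Γε ε N (suc k) (toℕ i) (toℕ j))
      pair zero    _  = lucas-0 , λ _ → lucas-1
      pair (suc k) lt = IH₁ , next
        where
        IH₀ : ∀ i j → lucas k i j ≡ Γε ε N k (toℕ i) (toℕ j)
        IH₀ = proj₁ (pair k (ℕP.<-trans (ℕP.n<1+n k) lt))
        IH₁ : ∀ i j → lucas (suc k) i j ≡ Γε ε N (suc k) (toℕ i) (toℕ j)
        IH₁ = proj₂ (pair k (ℕP.<-trans (ℕP.n<1+n k) lt)) lt
        next : suc (suc k) < N → ∀ i j → lucas (suc (suc k)) i j ≡ Γε ε N (suc (suc k)) (toℕ i) (toℕ j)
        next lt₂ i j = trans
          (cong₂ _-_ (trans (act-cong (lucas (suc k)) (λ l j′ → Γε ε N (suc k) (toℕ l) (toℕ j′)) IH₁ i j)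
                            (sumFin-cong N (λ l → cong (_* Γε ε N (suc k) (toℕ l) (toℕ j)) (entA i l))))
                     (IH₀ i j))
          (step k lt₂ (toℕ i) (toℕ j) (FinP.toℕ<n i) (FinP.toℕ<n j))

  ind-∨ : ∀ x y → (T x → T y → ⊥) → ind (x ∨ y) ≡ ind x + ind y
  ind-∨ true  true  excl = ⊥-elim (excl tt tt)
  ind-∨ true  false excl = refl
  ind-∨ false y     excl = sym (ℤP.+-identityˡ (ind y))

  T-∨ : ∀ x y → T (x ∨ y) → T x ⊎ T y
  T-∨ true  y t = inj₁ tt
  T-∨ false y t = inj₂ t

  ind-if : ∀ x y → (T x → T y → ⊥) → (if x then + 1 else if y then - (+ 1) else + 0) ≡ ind x - ind y
  ind-if true  true  excl = ⊥-elim (excl tt tt)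
  ind-if true  false excl = refl
  ind-if false true  excl = refl
  ind-if false false excl = refl

  ind-dist : ∀ x y k → ind (∣ x - y ∣ ≡ᵇ suc k) ≡ δ y (x ℕ.+ suc k) + δ x (y ℕ.+ suc k)
  ind-dist zero    y       k = sym (trans (cong (λ z → δ y (suc k) + z) (δʳ 0 (ℕP.+-suc y k))) (ℤP.+-identityʳ _))
  ind-dist (suc x) zero    k = sym (ℤP.+-identityˡ _)
  ind-dist (suc x) (suc y) k = ind-dist x y k

  dist≤+ : ∀ a b → ∣ a - b ∣ ≤ a ℕ.+ b
  dist≤+ zero    b       = ℕP.≤-refl
  dist≤+ (suc a) zero    = ℕP.≤-reflexive (cong suc (sym (ℕP.+-identityʳ a)))
  dist≤+ (suc a) (suc b) = ℕP.≤-trans (dist≤+ a b) (ℕP.≤-trans (ℕP.+-monoʳ-≤ a (ℕP.n≤1+n b)) (ℕP.n≤1+n _))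

  dist-parity : ∀ a b → Σ ℕ (λ m → a ℕ.+ b ≡ ∣ a - b ∣ ℕ.+ (m ℕ.+ m))
  dist-parity zero    b       = 0 , sym (ℕP.+-identityʳ b)
  dist-parity (suc a) zero    = 0 , cong suc (trans (ℕP.+-identityʳ a) (sym (ℕP.+-identityʳ a)))
  dist-parity (suc a) (suc b) with dist-parity a b
  ... | m , e = suc m , trans (e₁ a b) (trans (cong (λ z → suc (suc z)) e) (e₂ ∣ a - b ∣ m))
    where
    e₁ : ∀ a b → suc a ℕ.+ suc b ≡ suc (suc (a ℕ.+ b))
    e₁ = ℕSolver.solve-∀
    e₂ : ∀ d m → suc (suc (d ℕ.+ (m ℕ.+ m))) ≡ d ℕ.+ (suc m ℕ.+ suc m)
    e₂ = ℕSolver.solve-∀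

  odd≢even : ∀ x y → suc (x ℕ.+ x) ≢ y ℕ.+ y
  odd≢even zero    zero    ()
  odd≢even zero    (suc y) e with trans (ℕP.suc-injective e) (ℕP.+-suc y y)
  ... | ()
  odd≢even (suc x) zero    ()
  odd≢even (suc x) (suc y) e = odd≢even x y (ℕP.suc-injective (ℕP.suc-injective
    (trans (sym (cong (λ z → suc (suc z)) (ℕP.+-suc x x))) (trans e (cong suc (ℕP.+-suc y y))))))

  dist≢sum : ∀ i j k → T (∣ i - j ∣ ≡ᵇ suc k) → T (i ℕ.+ j ≡ᵇ k) → ⊥
  dist≢sum i j k t₁ t₂ = ℕP.<-irrefl refl
    (ℕP.≤-trans (ℕP.≤-reflexive (sym (ℕP.≡ᵇ⇒≡ _ _ t₁)))
                (ℕP.≤-trans (dist≤+ i j) (ℕP.≤-reflexive (ℕP.≡ᵇ⇒≡ _ _ t₂))))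

  γ^≡Γ : ∀ k i j → γ^ (suc k) i j ≡ Γ (suc k) i j
  γ^≡Γ k i j = trans (ind-∨ (∣ i - j ∣ ≡ᵇ suc k) (i ℕ.+ j ≡ᵇ k) (dist≢sum i j k))
                     (cong (_+ δ (i ℕ.+ j) k) (ind-dist i j k))

  module Targets (n k′ a c : ℕ) (k<n : k′ < n) where
    dist = ∣ a - c ∣ ≡ᵇ suc k′
    sum  = a ℕ.+ c ≡ᵇ k′
    far  = a ℕ.+ c ≡ᵇ 2 ℕ.* n ∸ k′
    corner = δ (suc (a ℕ.+ c ℕ.+ suc k′)) (suc n ℕ.+ suc n)

    far-sum : a ℕ.+ c ≡ 2 ℕ.* n ∸ k′ → a ℕ.+ c ℕ.+ k′ ≡ 2 ℕ.* n
    far-sum e = trans (cong (ℕ._+ k′) e) (ℕP.m∸n+n≡m (ℕP.≤-trans (ℕP.<⇒≤ k<n) (ℕP.m≤m+n n (n ℕ.+ 0))))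

    ind-far : ind far ≡ corner
    ind-far = δ-iff (λ e → trans (e₁ (a ℕ.+ c) k′) (trans (cong (λ z → suc (suc z)) (far-sum e)) (e₂ n)))
                    (λ e → trans (sym (ℕP.m+n∸n≡m (a ℕ.+ c) k′)) (cong (_∸ k′)
                       (ℕP.suc-injective (ℕP.suc-injective (trans (sym (e₁ (a ℕ.+ c) k′)) (trans e (sym (e₂ n))))))))
      where
      e₁ : ∀ x k → suc (x ℕ.+ suc k) ≡ suc (suc (x ℕ.+ k))
      e₁ = ℕSolver.solve-∀
      e₂ : ∀ n → suc (suc (2 ℕ.* n)) ≡ suc n ℕ.+ suc n
      e₂ = ℕSolver.solve-∀

    dist-far : T dist → T far → ⊥
    dist-far t₁ t₂ with dist-parity a c
    ... | m , e = odd≢even (k′ ℕ.+ m) n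
      (trans (e₁ k′ m) (trans (cong (λ z → z ℕ.+ (m ℕ.+ m) ℕ.+ k′) (sym (ℕP.≡ᵇ⇒≡ ∣ a - c ∣ (suc k′) t₁)))
        (trans (cong (ℕ._+ k′) (sym e)) (trans (far-sum (ℕP.≡ᵇ⇒≡ (a ℕ.+ c) (2 ℕ.* n ∸ k′) t₂)) (e₂ n)))))
      where
      e₁ : ∀ k m → suc ((k ℕ.+ m) ℕ.+ (k ℕ.+ m)) ≡ suc k ℕ.+ (m ℕ.+ m) ℕ.+ k
      e₁ = ℕSolver.solve-∀
      e₂ : ∀ n → 2 ℕ.* n ≡ n ℕ.+ n
      e₂ = ℕSolver.solve-∀

    sum-far : T sum → T far → ⊥
    sum-far t₁ t₂ = ℕP.<-irrefl
      (trans (trans (cong (ℕ._+ k′) (sym (ℕP.≡ᵇ⇒≡ (a ℕ.+ c) k′ t₁))) (far-sum (ℕP.≡ᵇ⇒≡ (a ℕ.+ c) (2 ℕ.* n ∸ k′) t₂)))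
             (e n))
      (ℕP.+-mono-< k<n k<n)
      where
      e : ∀ n → 2 ℕ.* n ≡ n ℕ.+ n
      e = ℕSolver.solve-∀

    bα≡Γε : bαTarget (suc n) (suc k′) a c ≡ Γε (+ 1) (suc n) (suc k′) a c
    bα≡Γε = begin
        ind (dist ∨ (sum ∨ far))
      ≡⟨ ind-∨ dist (sum ∨ far) (λ t₁ t₂ → either (dist≢sum a c k′ t₁) (dist-far t₁) (T-∨ sum far t₂)) ⟩
        ind dist + ind (sum ∨ far)
      ≡⟨ cong (λ z → ind dist + z) (ind-∨ sum far sum-far) ⟩
        ind dist + (ind sum + ind far)
      ≡⟨ cong₂ (λ u v → u + (ind sum + v)) (ind-dist a c k′) ind-far ⟩
        (δ c (a ℕ.+ suc k′) + δ a (c ℕ.+ suc k′)) + (δ (a ℕ.+ c) k′ + corner)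
      ≡⟨ regroup (δ c (a ℕ.+ suc k′)) (δ a (c ℕ.+ suc k′)) (δ (a ℕ.+ c) k′) corner ⟩
        Γε (+ 1) (suc n) (suc k′) a c ∎
      where
      open ≡-Reasoning
      regroup : ∀ x y z w → (x + y) + (z + w) ≡ x + y + z + + 1 * w
      regroup = solve-∀

    bβ≡Γε : bβTarget (suc n) (suc k′) a c ≡ Γε (- (+ 1)) (suc n) (suc k′) a c
    bβ≡Γε = begin
        (if dist ∨ sum then + 1 else if far then - (+ 1) else + 0)
      ≡⟨ ind-if (dist ∨ sum) far (λ t₁ t₂ → either (λ t → dist-far t t₂) (λ t → sum-far t t₂) (T-∨ dist sum t₁)) ⟩
        ind (dist ∨ sum) - ind far
      ≡⟨ cong₂ _-_ (ind-∨ dist sum (dist≢sum a c k′)) ind-far ⟩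
        (ind dist + ind sum) - corner
      ≡⟨ cong (λ u → (u + ind sum) - corner) (ind-dist a c k′) ⟩
        (δ c (a ℕ.+ suc k′) + δ a (c ℕ.+ suc k′) + δ (a ℕ.+ c) k′) - corner
      ≡⟨ regroup (δ c (a ℕ.+ suc k′)) (δ a (c ℕ.+ suc k′)) (δ (a ℕ.+ c) k′) corner ⟩
        Γε (- (+ 1)) (suc n) (suc k′) a c ∎
      where
      open ≡-Reasoning
      regroup : ∀ x y z w → (x + y + z) - w ≡ x + y + z + (- (+ 1)) * w
      regroup = solve-∀

  -- b_k(γ)

  γ⊗-cong : ∀ f g → (∀ i j → f i j ≡ g i j) → ∀ i j → γ⊗ f i j ≡ γ⊗ g i j
  γ⊗-cong f g e i j = trans (sumℕ≡ΣN (suc (suc i)) (λ l → γ i l * f l j))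
    (trans (ΣN-cong (suc (suc i)) (λ l _ → cong (γ i l *_) (e l j))) (sym (sumℕ≡ΣN (suc (suc i)) (λ l → γ i l * g l j))))

  γ⊗-lin : ∀ a b f g i j → γ⊗ (λ x y → a * f x y + b * g x y) i j ≡ a * γ⊗ f i j + b * γ⊗ g i j
  γ⊗-lin a b f g i j = begin
      sumℕ m (λ l → γ i l * (a * f l j + b * g l j))
    ≡⟨ sumℕ≡ΣN m (λ l → γ i l * (a * f l j + b * g l j)) ⟩
      ΣN m (λ l → γ i l * (a * f l j + b * g l j))
    ≡⟨ ΣN-cong m (λ l _ → distribute (γ i l) a b (f l j) (g l j)) ⟩
      ΣN m (λ l → a * (γ i l * f l j) + b * (γ i l * g l j))
    ≡⟨ ΣN-+ m (λ l → a * (γ i l * f l j)) (λ l → b * (γ i l * g l j)) ⟩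
      ΣN m (λ l → a * (γ i l * f l j)) + ΣN m (λ l → b * (γ i l * g l j))
    ≡⟨ cong₂ _+_ (ΣN-* m a (λ l → γ i l * f l j)) (ΣN-* m b (λ l → γ i l * g l j)) ⟩
      a * ΣN m (λ l → γ i l * f l j) + b * ΣN m (λ l → γ i l * g l j)
    ≡⟨ sym (cong₂ (λ u v → a * u + b * v) (sumℕ≡ΣN m (λ l → γ i l * f l j)) (sumℕ≡ΣN m (λ l → γ i l * g l j))) ⟩
      a * γ⊗ f i j + b * γ⊗ g i j ∎
    where
    open ≡-Reasoning
    m = suc (suc i)
    distribute : ∀ x a b u v → x * (a * u + b * v) ≡ a * (x * u) + b * (x * v)
    distribute = solve-∀

  module OnΓ = PolyAction ℕ idI γ⊗ γ⊗-cong γ⊗-lin evalγ (λ i j → refl) (λ c cs i j → refl)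

  γ-row₀ : ∀ (col : ℕ → ℤ) → sumℕ 2 (λ l → γ 0 l * col l) ≡ col 1 + col 0
  γ-row₀ col = simplify (col 1) (col 0)
    where
    simplify : ∀ x y → + 1 * x + (+ 1 * y + + 0) ≡ x + y
    simplify = solve-∀

  γ-row : ∀ i (col : ℕ → ℤ) → sumℕ (suc (suc (suc i))) (λ l → γ (suc i) l * col l) ≡ col (suc (suc i)) + col i
  γ-row i col = begin
      sumℕ m (λ l → γ (suc i) l * col l)
    ≡⟨ sumℕ≡ΣN m (λ l → γ (suc i) l * col l) ⟩
      ΣN m (λ l → γ (suc i) l * col l)
    ≡⟨ ΣN-cong m (λ l _ → trans (cong (_* col l) (γ-entry l)) (ℤP.*-distribʳ-+ (col l) (δ l (suc (suc i))) (δ l i))) ⟩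
      ΣN m (λ l → δ l (suc (suc i)) * col l + δ l i * col l)
    ≡⟨ ΣN-+ m (λ l → δ l (suc (suc i)) * col l) (λ l → δ l i * col l) ⟩
      ΣN m (λ l → δ l (suc (suc i)) * col l) + ΣN m (λ l → δ l i * col l)
    ≡⟨ cong₂ _+_ (ΣN-δ m (suc (suc i)) col (ℕP.n<1+n _))
                 (ΣN-δ m i col (ℕP.m<n⇒m<1+n (ℕP.m<n⇒m<1+n (ℕP.n<1+n i)))) ⟩
      col (suc (suc i)) + col i ∎
    where
    open ≡-Reasoning
    m = suc (suc (suc i))
    γ-entry : ∀ l → γ (suc i) l ≡ δ l (suc (suc i)) + δ l i
    γ-entry l = trans (γ^≡Γ 0 (suc i) l)
      (trans (cong₂ (λ u v → u + v + + 0) (δʳ l (cong suc (ℕP.+-comm i 1)))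
                    (trans (δʳ (suc i) (ℕP.+-comm l 1)) (δ-sym i l)))
             (ℤP.+-identityʳ _))

  lucas≡Γ : ∀ k → (∀ i j → OnΓ.lucas k i j ≡ Γ k i j) × (∀ i j → OnΓ.lucas (suc k) i j ≡ Γ (suc k) i j)
  lucas≡Γ zero = lucas-0 , lucas-1
    where
    lucas-0 : ∀ i j → OnΓ.lucas 0 i j ≡ Γ 0 i j
    lucas-0 i j = trans (double (δ i j))
      (sym (cong₂ (λ u v → u + v + + 0) (trans (δʳ j (ℕP.+-identityʳ i)) (δ-sym j i)) (δʳ i (ℕP.+-identityʳ j))))
      where
      double : ∀ d → + 2 * d ≡ d + d + + 0
      double = solve-∀
    lucas-1 : ∀ i j → OnΓ.lucas 1 i j ≡ Γ 1 i j
    lucas-1 zero    j = trans (γ-row₀ (λ l → idI l j)) (trans (cong₂ _+_ (δ-sym 1 j) (δ-sym 0 j))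
      (sym (trans (cong (λ z → δ j 1 + z + δ j 0) (δʳ 0 (ℕP.+-comm j 1))) (cong (_+ δ j 0) (ℤP.+-identityʳ (δ j 1))))))
    lucas-1 (suc i) j = trans (γ-row i (λ l → idI l j)) (trans (cong (_+ idI i j) (δ-sym (suc (suc i)) j))
      (sym (trans (cong₂ (λ u v → u + v + + 0) (δʳ j (cong suc (ℕP.+-comm i 1))) (δʳ (suc i) (ℕP.+-comm j 1)))
                  (ℤP.+-identityʳ _))))
  lucas≡Γ (suc k) = proj₂ IH , next
    where
    IH : (∀ i j → OnΓ.lucas k i j ≡ Γ k i j) × (∀ i j → OnΓ.lucas (suc k) i j ≡ Γ (suc k) i j)
    IH = lucas≡Γ k
    next : ∀ i j → OnΓ.lucas (suc (suc k)) i j ≡ Γ (suc (suc k)) i j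
    next zero    j = trans (cong₂ _-_ (trans (γ⊗-cong _ (Γ (suc k)) (proj₂ IH) 0 j) (γ-row₀ (λ l → Γ (suc k) l j)))
                                      (proj₁ IH 0 j))
                           (sym (Γ-rec₀ k j))
    next (suc i) j = trans (cong₂ _-_ (trans (γ⊗-cong _ (Γ (suc k)) (proj₂ IH) (suc i) j) (γ-row i (λ l → Γ (suc k) l j)))
                                      (proj₁ IH (suc i) j))
                           (sym (Γ-rec k i j))

  b[α] : ∀ n k′ → k′ < n → (i j : Fin (suc n)) →
         evalMat (suc n) (b (suc k′)) (α (suc n)) i j ≡ bαTarget (suc n) (suc k′) (toℕ i) (toℕ j)
  b[α] n k′ k′<n i j = begin
      evalMat (suc n) (b (suc k′)) (α (suc n)) i j ≡⟨ OnA.ev-b≡lucas (suc k′) (s≤s z≤n) i j ⟩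
      OnA.lucas (suc k′) i j                       ≡⟨ OnA.lucas≡Γε (suc k′) (s≤s k′<n) i j ⟩
      Γε (+ 1) (suc n) (suc k′) (toℕ i) (toℕ j)    ≡⟨ sym (Targets.bα≡Γε n k′ (toℕ i) (toℕ j) k′<n) ⟩
      bαTarget (suc n) (suc k′) (toℕ i) (toℕ j)    ∎
    where
    open ≡-Reasoning
    module OnA = FoldedLucas n (α (suc n)) (+ 1) refl (Qσ-entries (suc n) (+ 1))

  b[β] : ∀ n k′ → k′ < n → (i j : Fin (suc n)) →
         evalMat (suc n) (b (suc k′)) (β (suc n)) i j ≡ bβTarget (suc n) (suc k′) (toℕ i) (toℕ j)
  b[β] n k′ k′<n i j = begin
      evalMat (suc n) (b (suc k′)) (β (suc n)) i j ≡⟨ OnB.ev-b≡lucas (suc k′) (s≤s z≤n) i j ⟩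
      OnB.lucas (suc k′) i j                       ≡⟨ OnB.lucas≡Γε (suc k′) (s≤s k′<n) i j ⟩
      Γε (- (+ 1)) (suc n) (suc k′) (toℕ i) (toℕ j) ≡⟨ sym (Targets.bβ≡Γε n k′ (toℕ i) (toℕ j) k′<n) ⟩
      bβTarget (suc n) (suc k′) (toℕ i) (toℕ j)    ∎
    where
    open ≡-Reasoning
    module OnB = FoldedLucas n (β (suc n)) (- (+ 1)) refl (Qσ-entries (suc n) (- (+ 1)))

  b[γ]≡Γ : ∀ k′ i j → evalγ (b (suc k′)) i j ≡ Γ (suc k′) i j
  b[γ]≡Γ k′ i j = trans (OnΓ.ev-b≡lucas (suc k′) (s≤s z≤n) i j) (proj₁ (lucas≡Γ (suc k′)) i j)

  b[γ] : ∀ k′ i j → evalγ (b (suc k′)) i j ≡ γ^ (suc k′) i j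
  b[γ] k′ i j = trans (b[γ]≡Γ k′ i j) (sym (γ^≡Γ k′ i j))

  det-b[γ] : ∀ k′ M → let k = suc k′ ; D = detℤ M (restrict M (evalγ (b k))) in
      ((n : ℕ) → M ≡ 2 ℕ.* k ℕ.* n → D ≡ negOnePow (k ℕ.* n))
    × ((n : ℕ) → M ≡ 2 ℕ.* k ℕ.* n ℕ.+ k → D ≡ negOnePow (k ℕ.* n ℕ.+ k C 2))
    × (((n : ℕ) → (M ≢ 2 ℕ.* k ℕ.* n) × (M ≢ 2 ℕ.* k ℕ.* n ℕ.+ k)) → D ≡ + 0)
  det-b[γ] k′ M with DetΓ.det-Γ k′ M
  ... | even , odd , other = (λ n e → trans D≡ (even n e)) , (λ n e → trans D≡ (odd n e)) , (λ h → trans D≡ (other h))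
    where
    -- restrict M is the ℕ-indexed leading block, and b_k(γ) = Γ k entrywise
    D≡ : detℤ M (restrict M (evalγ (b (suc k′)))) ≡ detN M (Γ (suc k′))
    D≡ = detN-cong M (λ i j _ _ → b[γ]≡Γ k′ i j)

open Development using (b[α]; b[β]; b[γ]; det-b[γ])

open import Data.Nat using (ℕ; suc; s≤s; _≤_; _<_; _+_; _*_)
open import Data.Nat.Combinatorics using (_C_)
open import Data.Fin using (Fin; toℕ)
open import Data.Integer using (+_)
open import Data.Product using (_×_; _,_)
open import Relation.Binary.PropositionalEquality using (_≡_; _≢_)

lemma7p6 : (k N : ℕ) → 1 ≤ k → k < N →
    ((i j : Fin N) → evalMat N (b k) (α N) i j ≡ bαTarget N k (toℕ i) (toℕ j))
    × ((i j : Fin N) → evalMat N (b k) (β N) i j ≡ bβTarget N k (toℕ i) (toℕ j))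
    × ((i j : ℕ) → evalγ (b k) i j ≡ γ^ k i j)
    × ((M : ℕ) →
        ((n : ℕ) → M ≡ 2 * k * n →
           detℤ M (restrict M (evalγ (b k))) ≡ negOnePow (k * n))
        × ((n : ℕ) → M ≡ 2 * k * n + k →
           detℤ M (restrict M (evalγ (b k))) ≡ negOnePow (k * n + k C 2))
        × (((n : ℕ) → (M ≢ 2 * k * n) × (M ≢ 2 * k * n + k)) →
           detℤ M (restrict M (evalγ (b k))) ≡ + 0))
lemma7p6 (suc k′) (suc n) _ (s≤s k′<n) =
  b[α] n k′ k′<n , b[β] n k′ k′<n , b[γ] k′ , det-b[γ] k′
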